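{- Let $OABCD$ be an integer marked pyramid in $\mathbb R^3$ with vertex $O$ and base a parallelogram $ABCD$ which is integer-affine equivalent (within its plane) to the parallelogram with vertices $(1,0),(0,1),(-1,0),(0,-1)$. If $OABCD$ is completely empty and multistory, then it is two-story and is integer-affine equivalent to the marked pyramid with vertex $(0,0,0)$ and base $(2,-1,0),(2,-2,1),(2,-1,2),(2,0,1)$.
   Context: Integer means having integer coordinates / integer vertices. A marked pyramid is the union of the segments joining a marked vertex to the points of a base polygon not containing it; integer-affine equivalence of marked pyramids is via affine automorphisms of $\mathbb R^3$ preserving $\mathbb Z^3$ and sending vertex to vertex; a polygon in an integer plane is integer-affine equivalent to a polygon of $\mathbb R^2$ if an affine isomorphism between the plane and $\mathbb R^2$ matching the integer points maps one onto the other. Completely empty: no integer points besides the vertex and the integer points of the base. The pyramid is $l$-story if the integer distance from its vertex to the base plane is $l$ (integer distance from $P$ to $\pi$: Euclidean distance divided by the minimal nonzero Euclidean distance to $\pi$ of integer points of the affine span of $\pi\cup\{P\}$); multistory means $l>1$. -}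

module Defs where

open import Data.Nat using (ℕ) renaming (_<_ to _<ℕ_; _≤_ to _≤ℕ_)
open import Data.Integer using (ℤ; +_; -_; _+_; _-_; _*_; ∣_∣; 0ℤ; 1ℤ; -1ℤ)
open import Data.List using (List; []; _∷_; length)
open import Data.Nat.ListAction using (sum)
open import Data.Product using (Σ; ∃; _×_; _,_)
open import Data.Sum using (_⊎_)
open import Relation.Binary.PropositionalEquality using (_≡_; _≢_)
open import Data.List.Relation.Binary.Permutation.Propositional using (_↭_)

record V3 : Set where
  constructor v3
  field
    x y z : ℤ
open V3 public

infixl 6 _⊕_ _⊖_
_⊕_ : V3 → V3 → V3
v3 a b c ⊕ v3 d e f = v3 (a + d) (b + e) (c + f)

_⊖_ : V3 → V3 → V3
v3 a b c ⊖ v3 d e f = v3 (a - d) (b - e) (c - f)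

infixl 7 _·_
_·_ : ℤ → V3 → V3
k · v3 a b c = v3 (k * a) (k * b) (k * c)

origin : V3
origin = v3 0ℤ 0ℤ 0ℤ

dot : V3 → V3 → ℤ
dot (v3 a b c) (v3 d e f) = a * d + b * e + c * f

cross : V3 → V3 → V3
cross (v3 a b c) (v3 d e f) = v3 (b * f - c * e) (c * d - a * f) (a * e - b * d)

det3 : V3 → V3 → V3 → ℤ
det3 u v w = dot u (cross v w)

-- Convex hulls, tested on integer points.
-- X lies in conv(vs) iff X = Σ (wᵢ/N) vᵢ with wᵢ ∈ ℕ, N = Σ wᵢ > 0
-- (for integer vertices and an integer point X, rational coefficients
-- suffice).

lincomb : List ℕ → List V3 → V3
lincomb (w ∷ ws) (v ∷ vs) = ((+ w) · v) ⊕ lincomb ws vs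
lincomb _ _ = origin

InConv : List V3 → V3 → Set
InConv vs X = Σ (List ℕ) λ ws →
  length ws ≡ length vs × (0 <ℕ sum ws) × ((+ sum ws) · X ≡ lincomb ws vs)

-- The pyramid = union of segments from O to points of the base
--            = conv {O, A, B, C, D}.
InPyramid : (O A B C D : V3) → V3 → Set
InPyramid O A B C D = InConv (O ∷ A ∷ B ∷ C ∷ D ∷ [])

InBase : (A B C D : V3) → V3 → Set
InBase A B C D = InConv (A ∷ B ∷ C ∷ D ∷ [])

CompletelyEmpty : (O A B C D : V3) → Set
CompletelyEmpty O A B C D =
  ∀ X → InPyramid O A B C D X → X ≡ O ⊎ InBase A B C D X

-- The base ABCD is integer-affine equivalent (within its plane) to the
-- parallelogram (1,0),(0,1),(-1,0),(0,-1): there is an affine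
-- isomorphism φ(s,t) = Q + s e₁ + t e₂ of ℝ² onto the plane of the base
-- such that φ(ℤ²) is exactly the set of integer points of that plane,
-- and φ sends (1,0),(0,1),(-1,0),(0,-1) to A,B,C,D respectively.

-- the integer point P lies in the (real) plane Q + ℝe₁ + ℝe₂
-- (equivalently: rational coefficients, since P,Q,e₁,e₂ are integer)
InPlane : (Q e₁ e₂ : V3) → V3 → Set
InPlane Q e₁ e₂ P = Σ ℤ λ k → Σ ℤ λ a → Σ ℤ λ b →
  k ≢ 0ℤ × k · (P ⊖ Q) ≡ a · e₁ ⊕ b · e₂

LatticeBasisOfPlane : (Q e₁ e₂ : V3) → Set
LatticeBasisOfPlane Q e₁ e₂ =
  cross e₁ e₂ ≢ origin ×
  (∀ P → InPlane Q e₁ e₂ P → Σ ℤ λ s → Σ ℤ λ t → P ≡ Q ⊕ s · e₁ ⊕ t · e₂)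

BaseIsStandardDiamond : (A B C D : V3) → Set
BaseIsStandardDiamond A B C D = Σ V3 λ Q → Σ V3 λ e₁ → Σ V3 λ e₂ →
  LatticeBasisOfPlane Q e₁ e₂ ×
  A ≡ Q ⊕ e₁ × B ≡ Q ⊕ e₂ × C ≡ Q ⊖ e₁ × D ≡ Q ⊖ e₂

-- With n = (B - A) × (D - A) ≠ 0, the Euclidean distance
-- of a point X to π is |h X| / |n| where h X = n · (X - A).  As the
-- affine span of π ∪ {O} is ℝ³ (O ∉ π), the integer distance is
-- |h O| / m, m the least nonzero |h X| over integer points X; the
-- common factor |n| cancels.  "IntegerDistance O A B D l" says this
-- ratio equals l.

height : (A B D : V3) → V3 → ℤ
height A B D X = dot (cross (B ⊖ A) (D ⊖ A)) (X ⊖ A)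

MinNonzeroHeight : (A B D : V3) → ℕ → Set
MinNonzeroHeight A B D m =
  (0 <ℕ m) ×
  (Σ V3 λ X → ∣ height A B D X ∣ ≡ m) ×
  (∀ X → height A B D X ≢ 0ℤ → m ≤ℕ ∣ height A B D X ∣)

IntegerDistance : (O A B D : V3) → ℕ → Set
IntegerDistance O A B D l =
  Σ ℕ λ m → MinNonzeroHeight A B D m × ∣ height A B D O ∣ ≡ l Data.Nat.* m

-- Integer-affine equivalence of marked pyramids: an affine map
-- F(X) = t + x c₁ + y c₂ + z c₃ with integer columns of determinant ±1
-- (i.e. an affine automorphism of ℝ³ preserving ℤ³), sending vertex to
-- vertex and the base onto the base.  Since F is an affine bijection,
-- it maps the pyramid conv{O,A,B,C,D} onto conv{O',A',...} with O ↦ O'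
-- iff it maps the set of base vertices onto the set of base vertices.

record IntAffAuto : Set where
  constructor intAffAuto
  field
    c₁ c₂ c₃ t : V3
    unimodular : det3 c₁ c₂ c₃ ≡ 1ℤ ⊎ det3 c₁ c₂ c₃ ≡ -1ℤ

apply : IntAffAuto → V3 → V3
apply (intAffAuto c₁ c₂ c₃ t _) (v3 a b c) = t ⊕ a · c₁ ⊕ b · c₂ ⊕ c · c₃

PyramidEquiv : (O A B C D O' A' B' C' D' : V3) → Set
PyramidEquiv O A B C D O' A' B' C' D' = Σ IntAffAuto λ F →
  apply F O ≡ O' ×
  (apply F A ∷ apply F B ∷ apply F C ∷ apply F D ∷ []) ↭ (A' ∷ B' ∷ C' ∷ D' ∷ [])

-- Write the base as Q ± e₁, Q ± e₂, where e₁, e₂ is a basis of the integer points of its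
-- plane, and put N = e₁ × e₂.  The normal of a lattice plane is primitive, so a point of
-- minimal nonzero height gives e₃ with N · e₃ = ±1; then e₁, e₂, e₃ is a basis of ℤ³ and
-- the apex is O = Q + l e₃ + a e₁ + b e₂.  The section of the pyramid at height K contains
-- the integer point Q + K e₃ + s e₁ + t e₂ as soon as |l s - K a| + |l t - K b| ≤ l - K,
-- which emptiness forbids for 0 < K < l.  With K = 1 and s, t the nearest integers to
-- a / l, b / l, this forces a and b to lie halfway between multiples of l; but then K = 2
-- works unless l = 2, in which case a and b are odd.  In the frame -(e₃ + (a - 1)/2 e₁ +
-- (b + 1)/2 e₂), -e₂, -e₁ at the apex, the vertices then get the coordinates of the
-- standard two-story pyramid.
{-# OPTIONS --safe #-}
module Submission where

open import Defs
open import Data.Nat using (ℕ; _<_)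
open import Data.Integer using (+_; -[1+_])
open import Data.Product using (Σ; _×_)
open import Relation.Binary.PropositionalEquality using (_≢_)

open import Data.Empty using (⊥)
open import Data.Integer as ℤ using (ℤ; 0ℤ; 1ℤ; -1ℤ; ∣_∣; _+_; _-_; _*_; -_; NonZero; ≢-nonZero)
open import Data.Integer.DivMod using (_%_; _/_; _%ℕ_; _/ℕ_; a≡a%n+[a/n]*n; a≡a%ℕn+[a/ℕn]*n; n%d<d; n%ℕd<d)
open import Data.Integer.Divisibility.Signed using (_∣_; divides; ∣⇒∣ᵤ)
import Data.Integer.Properties as ℤₚ
open import Data.Integer.Tactic.RingSolver using (solve-∀)
open import Data.List.Base using ([]; _∷_)
open import Data.List.Relation.Binary.Permutation.Propositional using (↭-reflexive)
open import Data.Nat as ℕ using (zero; suc; _≤_; s≤s; z≤n)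
open import Data.Nat.Divisibility using (∣1⇒≡1)
open import Data.Nat.ListAction using (sum)
import Data.Nat.Properties as ℕₚ
import Data.Nat.Tactic.RingSolver as ℕ-Solver
open import Data.Product.Base using (_,_; proj₁; proj₂)
open import Data.Sum.Base using (_⊎_; inj₁; inj₂; [_,_]′)
open import Relation.Binary.PropositionalEquality using (_≡_; refl; sym; trans; cong; cong₂; subst; subst₂; module ≡-Reasoning)
open import Relation.Nullary using (yes; no)
open import Relation.Nullary.Negation using (¬_; contradiction)

v3-cong : ∀ {a b c a′ b′ c′} → a ≡ a′ → b ≡ b′ → c ≡ c′ → v3 a b c ≡ v3 a′ b′ c′
v3-cong refl refl refl = refl

cong₃ : ∀ {A B C D : Set} (f : A → B → C → D) {x x′ y y′ z z′} → x ≡ x′ → y ≡ y′ → z ≡ z′ → f x y z ≡ f x′ y′ z′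
cong₃ f refl refl refl = refl

i+j-j≡i : ∀ i j → i + j - j ≡ i
i+j-j≡i = solve-∀

i+j-i≡j : ∀ i j → i + j - i ≡ j
i+j-i≡j = solve-∀

[P⊕v]⊖P≡v : ∀ P v → (P ⊕ v) ⊖ P ≡ v
[P⊕v]⊖P≡v (v3 p₁ p₂ p₃) (v3 v₁ v₂ v₃) = v3-cong (i+j-i≡j p₁ v₁) (i+j-i≡j p₂ v₂) (i+j-i≡j p₃ v₃)

P⊕[X⊖P]≡X : ∀ P X → P ⊕ (X ⊖ P) ≡ X
P⊕[X⊖P]≡X (v3 p₁ p₂ p₃) (v3 x₁ x₂ x₃) = v3-cong (law p₁ x₁) (law p₂ x₂) (law p₃ x₃)
  where
  law : ∀ p x → p + (x - p) ≡ x
  law = solve-∀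

[P⊕u⊕v⊕w]⊖P≡u⊕v⊕w : ∀ P u v w → (P ⊕ u ⊕ v ⊕ w) ⊖ P ≡ u ⊕ v ⊕ w
[P⊕u⊕v⊕w]⊖P≡u⊕v⊕w (v3 p₁ p₂ p₃) (v3 u₁ u₂ u₃) (v3 v₁ v₂ v₃) (v3 w₁ w₂ w₃) =
  v3-cong (law p₁ u₁ v₁ w₁) (law p₂ u₂ v₂ w₂) (law p₃ u₃ v₃ w₃)
  where
  law : ∀ p u v w → p + u + v + w - p ≡ u + v + w
  law = solve-∀

⊕-assoc : ∀ u v w → u ⊕ v ⊕ w ≡ u ⊕ (v ⊕ w)
⊕-assoc (v3 u₁ u₂ u₃) (v3 v₁ v₂ v₃) (v3 w₁ w₂ w₃) =
  v3-cong (ℤₚ.+-assoc u₁ v₁ w₁) (ℤₚ.+-assoc u₂ v₂ w₂) (ℤₚ.+-assoc u₃ v₃ w₃)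

P⊕[u⊕v⊕w]≡P⊕u⊕v⊕w : ∀ P u v w → P ⊕ (u ⊕ v ⊕ w) ≡ P ⊕ u ⊕ v ⊕ w
P⊕[u⊕v⊕w]≡P⊕u⊕v⊕w (v3 p₁ p₂ p₃) (v3 u₁ u₂ u₃) (v3 v₁ v₂ v₃) (v3 w₁ w₂ w₃) =
  v3-cong (law p₁ u₁ v₁ w₁) (law p₂ u₂ v₂ w₂) (law p₃ u₃ v₃ w₃)
  where
  law : ∀ p u v w → p + (u + v + w) ≡ p + u + v + w
  law = solve-∀

u⊕0·v≡u : ∀ u v → u ⊕ 0ℤ · v ≡ u
u⊕0·v≡u (v3 u₁ u₂ u₃) (v3 _ _ _) = v3-cong (ℤₚ.+-identityʳ u₁) (ℤₚ.+-identityʳ u₂) (ℤₚ.+-identityʳ u₃)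

u⊖0·v≡u : ∀ u v → u ⊖ 0ℤ · v ≡ u
u⊖0·v≡u (v3 u₁ u₂ u₃) (v3 _ _ _) = v3-cong (ℤₚ.+-identityʳ u₁) (ℤₚ.+-identityʳ u₂) (ℤₚ.+-identityʳ u₃)

·-zeroˡ : ∀ v → 0ℤ · v ≡ origin
·-zeroˡ (v3 _ _ _) = refl

·-zeroʳ : ∀ a → a · origin ≡ origin
·-zeroʳ a = v3-cong (ℤₚ.*-zeroʳ a) (ℤₚ.*-zeroʳ a) (ℤₚ.*-zeroʳ a)

·-identityˡ : ∀ v → 1ℤ · v ≡ v
·-identityˡ (v3 v₁ v₂ v₃) = v3-cong (ℤₚ.*-identityˡ v₁) (ℤₚ.*-identityˡ v₂) (ℤₚ.*-identityˡ v₃)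

·-assoc : ∀ a b v → a · (b · v) ≡ (a * b) · v
·-assoc a b (v3 v₁ v₂ v₃) = v3-cong (sym (ℤₚ.*-assoc a b v₁)) (sym (ℤₚ.*-assoc a b v₂)) (sym (ℤₚ.*-assoc a b v₃))

neg·≡·neg : ∀ k v → (- k) · v ≡ k · (-1ℤ · v)
neg·≡·neg k (v3 v₁ v₂ v₃) = v3-cong (law k v₁) (law k v₂) (law k v₃)
  where
  law : ∀ k x → (- k) * x ≡ k * (-1ℤ * x)
  law = solve-∀

-- The components of a cross product are the cyclic shifts of one another, so one law
-- serves all three.
cross-·ˡ : ∀ c u v → cross (c · u) v ≡ c · cross u v
cross-·ˡ c (v3 u₁ u₂ u₃) (v3 v₁ v₂ v₃) = v3-cong (law c u₂ u₃ v₂ v₃) (law c u₃ u₁ v₃ v₁) (law c u₁ u₂ v₁ v₂)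
  where
  law : ∀ c p q r s → c * p * s - c * q * r ≡ c * (p * s - q * r)
  law = solve-∀

cross-combinationˡ : ∀ e₁ e₂ s t → cross (s · e₁ ⊕ t · e₂) e₂ ≡ s · cross e₁ e₂
cross-combinationˡ (v3 a₁ a₂ a₃) (v3 b₁ b₂ b₃) s t =
  v3-cong (law s t a₂ a₃ b₂ b₃) (law s t a₃ a₁ b₃ b₁) (law s t a₁ a₂ b₁ b₂)
  where
  law : ∀ s t p q r u → (s * p + t * r) * u - (s * q + t * u) * r ≡ s * (p * u - q * r)
  law = solve-∀

cross-combinationʳ : ∀ e₁ e₂ s t → cross e₁ (s · e₁ ⊕ t · e₂) ≡ t · cross e₁ e₂
cross-combinationʳ (v3 a₁ a₂ a₃) (v3 b₁ b₂ b₃) s t =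
  v3-cong (law s t a₂ a₃ b₂ b₃) (law s t a₃ a₁ b₃ b₁) (law s t a₁ a₂ b₁ b₂)
  where
  law : ∀ s t p q r u → p * (s * q + t * u) - q * (s * p + t * r) ≡ t * (p * u - q * r)
  law = solve-∀

dot-⊖· : ∀ N v c u → dot N (v ⊖ c · u) ≡ dot N v - c * dot N u
dot-⊖· (v3 n₁ n₂ n₃) (v3 v₁ v₂ v₃) c (v3 u₁ u₂ u₃) = expanded n₁ n₂ n₃ v₁ v₂ v₃ u₁ u₂ u₃ c
  where
  expanded : ∀ (n₁ n₂ n₃ v₁ v₂ v₃ u₁ u₂ u₃ c : ℤ) →
    n₁ * (v₁ - c * u₁) + n₂ * (v₂ - c * u₂) + n₃ * (v₃ - c * u₃)
      ≡ n₁ * v₁ + n₂ * v₂ + n₃ * v₃ - c * (n₁ * u₁ + n₂ * u₂ + n₃ * u₃)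
  expanded = solve-∀

dot-·ˡ : ∀ c u v → dot (c · u) v ≡ c * dot u v
dot-·ˡ c (v3 u₁ u₂ u₃) (v3 v₁ v₂ v₃) = expanded u₁ u₂ u₃ v₁ v₂ v₃ c
  where
  expanded : ∀ (u₁ u₂ u₃ v₁ v₂ v₃ c : ℤ) →
    c * u₁ * v₁ + c * u₂ * v₂ + c * u₃ * v₃
      ≡ c * (u₁ * v₁ + u₂ * v₂ + u₃ * v₃)
  expanded = solve-∀

dot-·ʳ : ∀ u c v → dot u (c · v) ≡ c * dot u v
dot-·ʳ (v3 u₁ u₂ u₃) c (v3 v₁ v₂ v₃) = expanded u₁ u₂ u₃ v₁ v₂ v₃ c
  where
  expanded : ∀ (u₁ u₂ u₃ v₁ v₂ v₃ c : ℤ) →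
    u₁ * (c * v₁) + u₂ * (c * v₂) + u₃ * (c * v₃)
      ≡ c * (u₁ * v₁ + u₂ * v₂ + u₃ * v₃)
  expanded = solve-∀

u·[u×v]≡0 : ∀ u v → dot u (cross u v) ≡ 0ℤ
u·[u×v]≡0 (v3 u₁ u₂ u₃) (v3 v₁ v₂ v₃) = expanded u₁ u₂ u₃ v₁ v₂ v₃
  where
  expanded : ∀ (u₁ u₂ u₃ v₁ v₂ v₃ : ℤ) →
    u₁ * (u₂ * v₃ - u₃ * v₂) + u₂ * (u₃ * v₁ - u₁ * v₃) + u₃ * (u₁ * v₂ - u₂ * v₁)
      ≡ 0ℤ
  expanded = solve-∀

[u×v]·u≡0 : ∀ u v → dot (cross u v) u ≡ 0ℤ
[u×v]·u≡0 (v3 u₁ u₂ u₃) (v3 v₁ v₂ v₃) = expanded u₁ u₂ u₃ v₁ v₂ v₃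
  where
  expanded : ∀ (u₁ u₂ u₃ v₁ v₂ v₃ : ℤ) →
    (u₂ * v₃ - u₃ * v₂) * u₁ + (u₃ * v₁ - u₁ * v₃) * u₂ + (u₁ * v₂ - u₂ * v₁) * u₃
      ≡ 0ℤ
  expanded = solve-∀

cross-cross : ∀ a b c → cross a (cross b c) ≡ dot a c · b ⊖ dot a b · c
cross-cross (v3 a₁ a₂ a₃) (v3 b₁ b₂ b₃) (v3 c₁ c₂ c₃) =
  v3-cong (x-component a₁ a₂ a₃ b₁ b₂ b₃ c₁ c₂ c₃) (y-component a₁ a₂ a₃ b₁ b₂ b₃ c₁ c₂ c₃) (z-component a₁ a₂ a₃ b₁ b₂ b₃ c₁ c₂ c₃)
  where
  x-component : ∀ (a₁ a₂ a₃ b₁ b₂ b₃ c₁ c₂ c₃ : ℤ) →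
    a₂ * (b₁ * c₂ - b₂ * c₁) - a₃ * (b₃ * c₁ - b₁ * c₃)
      ≡ (a₁ * c₁ + a₂ * c₂ + a₃ * c₃) * b₁ - (a₁ * b₁ + a₂ * b₂ + a₃ * b₃) * c₁
  x-component = solve-∀
  y-component : ∀ (a₁ a₂ a₃ b₁ b₂ b₃ c₁ c₂ c₃ : ℤ) →
    a₃ * (b₂ * c₃ - b₃ * c₂) - a₁ * (b₁ * c₂ - b₂ * c₁)
      ≡ (a₁ * c₁ + a₂ * c₂ + a₃ * c₃) * b₂ - (a₁ * b₁ + a₂ * b₂ + a₃ * b₃) * c₂
  y-component = solve-∀
  z-component : ∀ (a₁ a₂ a₃ b₁ b₂ b₃ c₁ c₂ c₃ : ℤ) →
    a₁ * (b₃ * c₁ - b₁ * c₃) - a₂ * (b₂ * c₃ - b₃ * c₂)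
      ≡ (a₁ * c₁ + a₂ * c₂ + a₃ * c₃) * b₃ - (a₁ * b₁ + a₂ * b₂ + a₃ * b₃) * c₃
  z-component = solve-∀

normal-frame-decomposition : ∀ e₁ e₂ w → let N = cross e₁ e₂ in
  dot N N · w ≡ dot (cross w e₂) N · e₁ ⊕ dot (cross e₁ w) N · e₂ ⊕ dot N w · N
normal-frame-decomposition (v3 a₁ a₂ a₃) (v3 b₁ b₂ b₃) (v3 w₁ w₂ w₃) =
  v3-cong (x-component a₁ a₂ a₃ b₁ b₂ b₃ w₁ w₂ w₃) (y-component a₁ a₂ a₃ b₁ b₂ b₃ w₁ w₂ w₃) (z-component a₁ a₂ a₃ b₁ b₂ b₃ w₁ w₂ w₃)
  where
  x-component : ∀ (a₁ a₂ a₃ b₁ b₂ b₃ w₁ w₂ w₃ : ℤ) →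
    ((a₂ * b₃ - a₃ * b₂) * (a₂ * b₃ - a₃ * b₂) + (a₃ * b₁ - a₁ * b₃) * (a₃ * b₁ - a₁ * b₃) + (a₁ * b₂ - a₂ * b₁) * (a₁ * b₂ - a₂ * b₁)) * w₁
      ≡ ((w₂ * b₃ - w₃ * b₂) * (a₂ * b₃ - a₃ * b₂) + (w₃ * b₁ - w₁ * b₃) * (a₃ * b₁ - a₁ * b₃) + (w₁ * b₂ - w₂ * b₁) * (a₁ * b₂ - a₂ * b₁)) * a₁ + ((a₂ * w₃ - a₃ * w₂) * (a₂ * b₃ - a₃ * b₂) + (a₃ * w₁ - a₁ * w₃) * (a₃ * b₁ - a₁ * b₃) + (a₁ * w₂ - a₂ * w₁) * (a₁ * b₂ - a₂ * b₁)) * b₁ + ((a₂ * b₃ - a₃ * b₂) * w₁ + (a₃ * b₁ - a₁ * b₃) * w₂ + (a₁ * b₂ - a₂ * b₁) * w₃) * (a₂ * b₃ - a₃ * b₂)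
  x-component = solve-∀
  y-component : ∀ (a₁ a₂ a₃ b₁ b₂ b₃ w₁ w₂ w₃ : ℤ) →
    ((a₂ * b₃ - a₃ * b₂) * (a₂ * b₃ - a₃ * b₂) + (a₃ * b₁ - a₁ * b₃) * (a₃ * b₁ - a₁ * b₃) + (a₁ * b₂ - a₂ * b₁) * (a₁ * b₂ - a₂ * b₁)) * w₂
      ≡ ((w₂ * b₃ - w₃ * b₂) * (a₂ * b₃ - a₃ * b₂) + (w₃ * b₁ - w₁ * b₃) * (a₃ * b₁ - a₁ * b₃) + (w₁ * b₂ - w₂ * b₁) * (a₁ * b₂ - a₂ * b₁)) * a₂ + ((a₂ * w₃ - a₃ * w₂) * (a₂ * b₃ - a₃ * b₂) + (a₃ * w₁ - a₁ * w₃) * (a₃ * b₁ - a₁ * b₃) + (a₁ * w₂ - a₂ * w₁) * (a₁ * b₂ - a₂ * b₁)) * b₂ + ((a₂ * b₃ - a₃ * b₂) * w₁ + (a₃ * b₁ - a₁ * b₃) * w₂ + (a₁ * b₂ - a₂ * b₁) * w₃) * (a₃ * b₁ - a₁ * b₃)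
  y-component = solve-∀
  z-component : ∀ (a₁ a₂ a₃ b₁ b₂ b₃ w₁ w₂ w₃ : ℤ) →
    ((a₂ * b₃ - a₃ * b₂) * (a₂ * b₃ - a₃ * b₂) + (a₃ * b₁ - a₁ * b₃) * (a₃ * b₁ - a₁ * b₃) + (a₁ * b₂ - a₂ * b₁) * (a₁ * b₂ - a₂ * b₁)) * w₃
      ≡ ((w₂ * b₃ - w₃ * b₂) * (a₂ * b₃ - a₃ * b₂) + (w₃ * b₁ - w₁ * b₃) * (a₃ * b₁ - a₁ * b₃) + (w₁ * b₂ - w₂ * b₁) * (a₁ * b₂ - a₂ * b₁)) * a₃ + ((a₂ * w₃ - a₃ * w₂) * (a₂ * b₃ - a₃ * b₂) + (a₃ * w₁ - a₁ * w₃) * (a₃ * b₁ - a₁ * b₃) + (a₁ * w₂ - a₂ * w₁) * (a₁ * b₂ - a₂ * b₁)) * b₃ + ((a₂ * b₃ - a₃ * b₂) * w₁ + (a₃ * b₁ - a₁ * b₃) * w₂ + (a₁ * b₂ - a₂ * b₁) * w₃) * (a₁ * b₂ - a₂ * b₁)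
  z-component = solve-∀

square≡∣∣² : ∀ i → i * i ≡ + (∣ i ∣ ℕ.* ∣ i ∣)
square≡∣∣² (+ n) = sym (ℤₚ.pos-* n n)
square≡∣∣² -[1+ n ] = refl

∣∣²≡0⇒≡0 : ∀ i → ∣ i ∣ ℕ.* ∣ i ∣ ≡ 0 → i ≡ 0ℤ
∣∣²≡0⇒≡0 i sq≡0 with ℕₚ.m*n≡0⇒m≡0∨n≡0 ∣ i ∣ sq≡0
... | inj₁ ∣i∣≡0 = ℤₚ.∣i∣≡0⇒i≡0 ∣i∣≡0
... | inj₂ ∣i∣≡0 = ℤₚ.∣i∣≡0⇒i≡0 ∣i∣≡0

dot-self≢0 : ∀ v → v ≢ origin → dot v v ≢ 0ℤ
dot-self≢0 (v3 a b c) v≢0 v·v≡0 =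
  v≢0 (v3-cong (∣∣²≡0⇒≡0 a A≡0) (∣∣²≡0⇒≡0 b B≡0) (∣∣²≡0⇒≡0 c C≡0))
  where
  A = ∣ a ∣ ℕ.* ∣ a ∣
  B = ∣ b ∣ ℕ.* ∣ b ∣
  C = ∣ c ∣ ℕ.* ∣ c ∣
  sum≡0 : A ℕ.+ B ℕ.+ C ≡ 0
  sum≡0 = ℤₚ.+-injective (trans (sym squares) v·v≡0)
    where
    squares : a * a + b * b + c * c ≡ + (A ℕ.+ B ℕ.+ C)
    squares = cong₂ _+_ (cong₂ _+_ (square≡∣∣² a) (square≡∣∣² b)) (square≡∣∣² c)
  A≡0 = ℕₚ.m+n≡0⇒m≡0 A (ℕₚ.m+n≡0⇒m≡0 (A ℕ.+ B) sum≡0)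
  B≡0 = ℕₚ.m+n≡0⇒n≡0 A (ℕₚ.m+n≡0⇒m≡0 (A ℕ.+ B) sum≡0)
  C≡0 = ℕₚ.m+n≡0⇒n≡0 (A ℕ.+ B) sum≡0

⊕-cancelˡ : ∀ P u v w → P ⊕ u ≡ P ⊕ v ⊕ w → u ≡ v ⊕ w
⊕-cancelˡ P u v w eq = begin
  u                   ≡⟨ [P⊕v]⊖P≡v P u ⟨
  (P ⊕ u) ⊖ P         ≡⟨ cong (_⊖ P) (trans eq (⊕-assoc P v w)) ⟩
  (P ⊕ (v ⊕ w)) ⊖ P   ≡⟨ [P⊕v]⊖P≡v P (v ⊕ w) ⟩
  v ⊕ w               ∎
  where open ≡-Reasoning

·-cancelʳ : ∀ α β n → n ≢ origin → α · n ≡ β · n → α ≡ β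
·-cancelʳ α β (v3 a b c) n≢0 eq with a ℤ.≟ 0ℤ | b ℤ.≟ 0ℤ | c ℤ.≟ 0ℤ
... | no a≢0 | _ | _ = ℤₚ.*-cancelʳ-≡ α β a {{≢-nonZero a≢0}} (cong V3.x eq)
... | yes _ | no b≢0 | _ = ℤₚ.*-cancelʳ-≡ α β b {{≢-nonZero b≢0}} (cong V3.y eq)
... | yes _ | yes _ | no c≢0 = ℤₚ.*-cancelʳ-≡ α β c {{≢-nonZero c≢0}} (cong V3.z eq)
... | yes refl | yes refl | yes refl = contradiction refl n≢0

multiple-of-dots : ∀ {d} u → (∀ v → d ∣ dot u v) → Σ V3 λ n → u ≡ d · n
multiple-of-dots {d} (v3 a b c) d∣u·
  with d∣u· (v3 1ℤ 0ℤ 0ℤ) | d∣u· (v3 0ℤ 1ℤ 0ℤ) | d∣u· (v3 0ℤ 0ℤ 1ℤ)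
... | divides p a≡ | divides q b≡ | divides r c≡ =
  v3 p q r , v3-cong (trans (x-law a b c) (trans a≡ (ℤₚ.*-comm p d)))
                     (trans (y-law a b c) (trans b≡ (ℤₚ.*-comm q d)))
                     (trans (z-law a b c) (trans c≡ (ℤₚ.*-comm r d)))
  where
  x-law : ∀ a b c → a ≡ a * 1ℤ + b * 0ℤ + c * 0ℤ
  x-law = solve-∀
  y-law : ∀ a b c → b ≡ a * 0ℤ + b * 1ℤ + c * 0ℤ
  y-law = solve-∀
  z-law : ∀ a b c → c ≡ a * 0ℤ + b * 0ℤ + c * 1ℤ
  z-law = solve-∀

nonzero-factors : ∀ u d n → u ≢ origin → u ≡ d · n → d ≢ 0ℤ × n ≢ origin
nonzero-factors u d n u≢0 u≡dn = (λ { refl → u≢0 (trans u≡dn (·-zeroˡ n)) })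
                               , (λ { refl → u≢0 (trans u≡dn (·-zeroʳ d)) })

-- The lattice of the base plane

Unimodular : ℤ → Set
Unimodular d = d ≡ 1ℤ ⊎ d ≡ -1ℤ

∣1⇒unimodular : ∀ {d} → d ∣ 1ℤ → Unimodular d
∣1⇒unimodular {d} d∣1 = go d (∣1⇒≡1 (∣⇒∣ᵤ d∣1))
  where
  go : ∀ d → ∣ d ∣ ≡ 1 → Unimodular d
  go (+ .1) refl = inj₁ refl
  go -[1+ 0 ] refl = inj₂ refl

∣unimodular∣ : ∀ {d} → Unimodular d → ∣ d ∣ ≡ 1
∣unimodular∣ (inj₁ refl) = refl
∣unimodular∣ (inj₂ refl) = refl

unimodular-∣∣ : ∀ {d} → Unimodular d → ∀ h → ∣ d * h ∣ ≡ ∣ h ∣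
unimodular-∣∣ {d} u h = trans (ℤₚ.abs-* d h) (trans (cong (ℕ._* ∣ h ∣) (∣unimodular∣ u)) (ℕₚ.*-identityˡ ∣ h ∣))

unimodular-square : ∀ {d} → Unimodular d → d * d ≡ 1ℤ
unimodular-square (inj₁ refl) = refl
unimodular-square (inj₂ refl) = refl

unimodular-fifth-power : ∀ {d} → Unimodular d → Unimodular (d * d * d * (d * d))
unimodular-fifth-power (inj₁ refl) = inj₁ refl
unimodular-fifth-power (inj₂ refl) = inj₂ refl

unimodular≢0 : ∀ {d} → Unimodular d → d ≢ 0ℤ
unimodular≢0 (inj₁ refl) ()
unimodular≢0 (inj₂ refl) ()

unimodular-neg : ∀ {d} → Unimodular d → Unimodular (-1ℤ * d)
unimodular-neg (inj₁ refl) = inj₂ refl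
unimodular-neg (inj₂ refl) = inj₁ refl

unimodular-cancel : ∀ {d} → Unimodular d → ∀ h → h - d * h * d ≡ 0ℤ
unimodular-cancel (inj₁ refl) = solve-∀
unimodular-cancel (inj₂ refl) = solve-∀

cancel-nonzero-factor : ∀ d i → d ≢ 0ℤ → d * i ≡ 0ℤ → i ≡ 0ℤ
cancel-nonzero-factor d i d≢0 di≡0 with ℤₚ.i*j≡0⇒i≡0∨j≡0 d di≡0
... | inj₁ d≡0 = contradiction d≡0 d≢0
... | inj₂ i≡0 = i≡0

divides-if-remainders-large : ∀ ζ h → ζ ≢ 0ℤ → (∀ q → h - q * ζ ≢ 0ℤ → ∣ ζ ∣ ≤ ∣ h - q * ζ ∣) → ζ ∣ h
divides-if-remainders-large ζ h ζ≢0 large = go {{≢-nonZero ζ≢0}}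
  where
  go : {{NonZero ζ}} → ζ ∣ h
  go with h % ζ | a≡a%n+[a/n]*n h ζ | n%d<d h ζ
  ... | zero | h≡ | _ = divides (h / ζ) (trans h≡ (ℤₚ.+-identityˡ (h / ζ * ζ)))
  ... | suc r | h≡ | r<∣ζ∣ = contradiction (large (h / ζ) h-qζ≢0) (ℕₚ.<⇒≱ (subst (ℕ._< ∣ ζ ∣) (sym (cong ∣_∣ h-qζ≡)) r<∣ζ∣))
    where
    h-qζ≡ : h - h / ζ * ζ ≡ + suc r
    h-qζ≡ = trans (cong (_- h / ζ * ζ) h≡) (i+j-j≡i (+ suc r) (h / ζ * ζ))
    h-qζ≢0 : h - h / ζ * ζ ≢ 0ℤ
    h-qζ≢0 eq with trans (sym h-qζ≡) eq
    ... | ()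

minimal-divides : ∀ N u → dot N u ≢ 0ℤ → (∀ v → dot N v ≢ 0ℤ → ∣ dot N u ∣ ≤ ∣ dot N v ∣) →
  ∀ v → dot N u ∣ dot N v
minimal-divides N u ζ≢0 minimal v = divides-if-remainders-large (dot N u) (dot N v) ζ≢0 λ q →
  subst (λ i → i ≢ 0ℤ → ∣ dot N u ∣ ≤ ∣ i ∣) (dot-⊖· N v q u) (minimal (v ⊖ q · u))

absorb-sign : ∀ N u → Unimodular (dot N u) → ∀ k →
  Σ V3 λ u′ → Unimodular (dot N u′) × k · u ≡ (+ ∣ k ∣) · u′
absorb-sign N u unit (+ n) = u , unit , refl
absorb-sign N u unit -[1+ n ] =
  -1ℤ · u , subst Unimodular (sym (dot-·ʳ N -1ℤ u)) (unimodular-neg unit) , neg·≡·neg (+ suc n) u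

height-diamond : ∀ Q e₁ e₂ X → height (Q ⊕ e₁) (Q ⊕ e₂) (Q ⊖ e₂) X ≡ + 2 * dot (cross e₁ e₂) (X ⊖ Q)
height-diamond (v3 q₁ q₂ q₃) (v3 a₁ a₂ a₃) (v3 b₁ b₂ b₃) (v3 x₁ x₂ x₃) = expanded q₁ q₂ q₃ a₁ a₂ a₃ b₁ b₂ b₃ x₁ x₂ x₃
  where
  expanded : ∀ (q₁ q₂ q₃ a₁ a₂ a₃ b₁ b₂ b₃ x₁ x₂ x₃ : ℤ) →
    ((q₂ + b₂ - (q₂ + a₂)) * (q₃ - b₃ - (q₃ + a₃)) - (q₃ + b₃ - (q₃ + a₃)) * (q₂ - b₂ - (q₂ + a₂))) * (x₁ - (q₁ + a₁)) + ((q₃ + b₃ - (q₃ + a₃)) * (q₁ - b₁ - (q₁ + a₁)) - (q₁ + b₁ - (q₁ + a₁)) * (q₃ - b₃ - (q₃ + a₃))) * (x₂ - (q₂ + a₂)) + ((q₁ + b₁ - (q₁ + a₁)) * (q₂ - b₂ - (q₂ + a₂)) - (q₂ + b₂ - (q₂ + a₂)) * (q₁ - b₁ - (q₁ + a₁))) * (x₃ - (q₃ + a₃))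
      ≡ (+ 2) * ((a₂ * b₃ - a₃ * b₂) * (x₁ - q₁) + (a₃ * b₁ - a₁ * b₃) * (x₂ - q₂) + (a₁ * b₂ - a₂ * b₁) * (x₃ - q₃))
  expanded = solve-∀

∣height-diamond∣ : ∀ Q e₁ e₂ v → ∣ height (Q ⊕ e₁) (Q ⊕ e₂) (Q ⊖ e₂) (Q ⊕ v) ∣ ≡ 2 ℕ.* ∣ dot (cross e₁ e₂) v ∣
∣height-diamond∣ Q e₁ e₂ v = begin
  ∣ height (Q ⊕ e₁) (Q ⊕ e₂) (Q ⊖ e₂) (Q ⊕ v) ∣   ≡⟨ cong ∣_∣ (height-diamond Q e₁ e₂ (Q ⊕ v)) ⟩
  ∣ + 2 * dot (cross e₁ e₂) ((Q ⊕ v) ⊖ Q) ∣        ≡⟨ cong (λ w → ∣ + 2 * dot (cross e₁ e₂) w ∣) ([P⊕v]⊖P≡v Q v) ⟩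
  ∣ + 2 * dot (cross e₁ e₂) v ∣                     ≡⟨ ℤₚ.abs-* (+ 2) (dot (cross e₁ e₂) v) ⟩
  2 ℕ.* ∣ dot (cross e₁ e₂) v ∣                     ∎
  where open ≡-Reasoning

module PlaneLattice (Q e₁ e₂ : V3) (lattice : LatticeBasisOfPlane Q e₁ e₂) where

  N : V3
  N = cross e₁ e₂

  orthogonal⇒combination : ∀ w → dot N w ≡ 0ℤ → Σ ℤ λ s → Σ ℤ λ t → w ≡ s · e₁ ⊕ t · e₂
  orthogonal⇒combination w N·w≡0 =
    let s , t , Q⊕w≡ = proj₂ lattice (Q ⊕ w) (dot N N , dot (cross w e₂) N , dot (cross e₁ w) N ,
                                               dot-self≢0 N (proj₁ lattice) , in-plane)
    in s , t , ⊕-cancelˡ Q w (s · e₁) (t · e₂) Q⊕w≡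
    where
    in-plane : dot N N · ((Q ⊕ w) ⊖ Q) ≡ dot (cross w e₂) N · e₁ ⊕ dot (cross e₁ w) N · e₂
    in-plane = trans (cong (dot N N ·_) ([P⊕v]⊖P≡v Q w)) (trans (normal-frame-decomposition e₁ e₂ w)
      (trans (cong (λ h → dot (cross w e₂) N · e₁ ⊕ dot (cross e₁ w) N · e₂ ⊕ h · N) N·w≡0)
             (u⊕0·v≡u (dot (cross w e₂) N · e₁ ⊕ dot (cross e₁ w) N · e₂) N)))

  normal-divisor-divides-e₁ : ∀ d n → N ≡ d · n → d ≢ 0ℤ → ∀ v → d ∣ dot e₁ v
  normal-divisor-divides-e₁ d n N≡dn d≢0 v =
    let s , t , n×v≡ = orthogonal⇒combination (cross n v) n×v⊥N
    in divides t (·-cancelʳ (dot e₁ v) (t * d) n (proj₂ (nonzero-factors N d n (proj₁ lattice) N≡dn))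
                            (e₁·v·n≡ s t n×v≡))
    where
    open ≡-Reasoning
    n×v⊥N : dot N (cross n v) ≡ 0ℤ
    n×v⊥N = begin
      dot N (cross n v)         ≡⟨ cong (λ M → dot M (cross n v)) N≡dn ⟩
      dot (d · n) (cross n v)   ≡⟨ dot-·ˡ d n (cross n v) ⟩
      d * dot n (cross n v)     ≡⟨ cong (d *_) (u·[u×v]≡0 n v) ⟩
      d * 0ℤ                    ≡⟨ ℤₚ.*-zeroʳ d ⟩
      0ℤ                        ∎
    e₁·n≡0 : dot e₁ n ≡ 0ℤ
    e₁·n≡0 = cancel-nonzero-factor d (dot e₁ n) d≢0
      (trans (sym (dot-·ʳ e₁ d n)) (trans (cong (dot e₁) (sym N≡dn)) (u·[u×v]≡0 e₁ e₂)))
    e₁·v·n≡ : ∀ s t → cross n v ≡ s · e₁ ⊕ t · e₂ → dot e₁ v · n ≡ (t * d) · n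
    e₁·v·n≡ s t n×v≡ = begin
      dot e₁ v · n                  ≡⟨ u⊖0·v≡u (dot e₁ v · n) v ⟨
      dot e₁ v · n ⊖ 0ℤ · v         ≡⟨ cong (λ c → dot e₁ v · n ⊖ c · v) e₁·n≡0 ⟨
      dot e₁ v · n ⊖ dot e₁ n · v   ≡⟨ cross-cross e₁ n v ⟨
      cross e₁ (cross n v)          ≡⟨ cong (cross e₁) n×v≡ ⟩
      cross e₁ (s · e₁ ⊕ t · e₂)    ≡⟨ cross-combinationʳ e₁ e₂ s t ⟩
      t · N                         ≡⟨ cong (t ·_) N≡dn ⟩
      t · (d · n)                   ≡⟨ ·-assoc t d n ⟩
      (t * d) · n                   ∎

  normal-primitive : ∀ d → (∀ v → d ∣ dot N v) → Unimodular d
  normal-primitive d d∣N· =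
    let n , N≡dn = multiple-of-dots N d∣N·
        d≢0 = proj₁ (nonzero-factors N d n (proj₁ lattice) N≡dn)
        f , e₁≡df = multiple-of-dots e₁ (normal-divisor-divides-e₁ d n N≡dn d≢0)
        g = cross f e₂
        N≡dg = trans (cong (λ u → cross u e₂) e₁≡df) (cross-·ˡ d f e₂)
        s , t , f≡ = orthogonal⇒combination f (f⊥N d≢0 f e₁≡df)
    in ∣1⇒unimodular (divides s (·-cancelʳ 1ℤ (s * d) g (proj₂ (nonzero-factors N d g (proj₁ lattice) N≡dg))
                                            (g≡ f s t f≡ N≡dg)))
    where
    open ≡-Reasoning
    f⊥N : d ≢ 0ℤ → ∀ f → e₁ ≡ d · f → dot N f ≡ 0ℤ
    f⊥N d≢0 f e₁≡df = cancel-nonzero-factor d (dot N f) d≢0 (begin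
      d * dot N f      ≡⟨ dot-·ʳ N d f ⟨
      dot N (d · f)    ≡⟨ cong (dot N) e₁≡df ⟨
      dot N e₁         ≡⟨ [u×v]·u≡0 e₁ e₂ ⟩
      0ℤ               ∎)
    g≡ : ∀ f s t → f ≡ s · e₁ ⊕ t · e₂ → N ≡ d · cross f e₂ → 1ℤ · cross f e₂ ≡ (s * d) · cross f e₂
    g≡ f s t f≡ N≡dg = begin
      1ℤ · cross f e₂              ≡⟨ ·-identityˡ (cross f e₂) ⟩
      cross f e₂                   ≡⟨ cong (λ u → cross u e₂) f≡ ⟩
      cross (s · e₁ ⊕ t · e₂) e₂   ≡⟨ cross-combinationˡ e₁ e₂ s t ⟩
      s · N                        ≡⟨ cong (s ·_) N≡dg ⟩
      s · (d · cross f e₂)         ≡⟨ ·-assoc s d (cross f e₂) ⟩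
      (s * d) · cross f e₂         ∎

  basis-decomposition : ∀ e₃ → Unimodular (dot N e₃) →
    ∀ v → Σ ℤ λ s → Σ ℤ λ t → v ≡ (dot N e₃ * dot N v) · e₃ ⊕ s · e₁ ⊕ t · e₂
  basis-decomposition e₃ unit v =
    let s , t , w≡ = orthogonal⇒combination (v ⊖ c · e₃) (trans (dot-⊖· N v c e₃) (unimodular-cancel unit (dot N v)))
    in s , t , (begin
      v                           ≡⟨ P⊕[X⊖P]≡X (c · e₃) v ⟨
      c · e₃ ⊕ (v ⊖ c · e₃)       ≡⟨ cong (c · e₃ ⊕_) w≡ ⟩
      c · e₃ ⊕ (s · e₁ ⊕ t · e₂)  ≡⟨ ⊕-assoc (c · e₃) (s · e₁) (t · e₂) ⟨
      c · e₃ ⊕ s · e₁ ⊕ t · e₂    ∎)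
    where
    c = dot N e₃ * dot N v
    open ≡-Reasoning

  minimal-height-witness : ∀ m → MinNonzeroHeight (Q ⊕ e₁) (Q ⊕ e₂) (Q ⊖ e₂) m →
    m ≡ 2 × Σ V3 λ u → Unimodular (dot N u)
  minimal-height-witness m (0<m , (X₀ , ∣hX₀∣≡m) , minimal) =
    trans (sym 2∣ζ∣≡m) (cong (2 ℕ.*_) (∣unimodular∣ ζ-unit)) , u , ζ-unit
    where
    u = X₀ ⊖ Q
    ζ = dot N u
    2∣ζ∣≡m : 2 ℕ.* ∣ ζ ∣ ≡ m
    2∣ζ∣≡m = trans (sym (∣height-diamond∣ Q e₁ e₂ u))
                   (trans (cong (λ X → ∣ height (Q ⊕ e₁) (Q ⊕ e₂) (Q ⊖ e₂) X ∣) (P⊕[X⊖P]≡X Q X₀)) ∣hX₀∣≡m)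
    ζ≢0 : ζ ≢ 0ℤ
    ζ≢0 ζ≡0 = ℕₚ.<-irrefl refl (subst (λ i → 0 < 2 ℕ.* ∣ i ∣) ζ≡0 (subst (0 <_) (sym 2∣ζ∣≡m) 0<m))
    ζ-minimal : ∀ v → dot N v ≢ 0ℤ → ∣ ζ ∣ ≤ ∣ dot N v ∣
    ζ-minimal v N·v≢0 = ℕₚ.*-cancelˡ-≤ 2
      (subst₂ _≤_ (sym 2∣ζ∣≡m) (∣height-diamond∣ Q e₁ e₂ v) (minimal (Q ⊕ v) height≢0))
      where
      height≢0 : height (Q ⊕ e₁) (Q ⊕ e₂) (Q ⊖ e₂) (Q ⊕ v) ≢ 0ℤ
      height≢0 h≡0 = N·v≢0 (ℤₚ.∣i∣≡0⇒i≡0 (ℕₚ.*-cancelˡ-≡ ∣ dot N v ∣ 0 2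
        (trans (sym (∣height-diamond∣ Q e₁ e₂ v)) (cong ∣_∣ h≡0))))
    ζ-unit : Unimodular ζ
    ζ-unit = normal-primitive ζ (minimal-divides N u ζ≢0 ζ-minimal)

  apex-normal-form : ∀ O l → IntegerDistance O (Q ⊕ e₁) (Q ⊕ e₂) (Q ⊖ e₂) l →
    Σ V3 λ e₃ → Σ ℤ λ a → Σ ℤ λ b → Unimodular (dot N e₃) × O ≡ Q ⊕ (+ l) · e₃ ⊕ a · e₁ ⊕ b · e₂
  apex-normal-form O l (m , min-height , ∣hO∣≡lm) =
    let m≡2 , u , u-unit = minimal-height-witness m min-height
        a , b , O⊖Q≡ = basis-decomposition u u-unit (O ⊖ Q)
        k = dot N u * dot N (O ⊖ Q)
        e₃ , e₃-unit , ku≡ = absorb-sign N u u-unit k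
    in e₃ , a , b , e₃-unit , (begin
      O                                          ≡⟨ P⊕[X⊖P]≡X Q O ⟨
      Q ⊕ (O ⊖ Q)                                ≡⟨ cong (Q ⊕_) O⊖Q≡ ⟩
      Q ⊕ (k · u ⊕ a · e₁ ⊕ b · e₂)              ≡⟨ cong (λ w → Q ⊕ (w ⊕ a · e₁ ⊕ b · e₂)) ku≡ ⟩
      Q ⊕ ((+ ∣ k ∣) · e₃ ⊕ a · e₁ ⊕ b · e₂)     ≡⟨ cong (λ n → Q ⊕ ((+ n) · e₃ ⊕ a · e₁ ⊕ b · e₂))
                                                         (trans (unimodular-∣∣ u-unit (dot N (O ⊖ Q))) (∣N·OQ∣≡l m≡2)) ⟩
      Q ⊕ ((+ l) · e₃ ⊕ a · e₁ ⊕ b · e₂)         ≡⟨ P⊕[u⊕v⊕w]≡P⊕u⊕v⊕w Q ((+ l) · e₃) (a · e₁) (b · e₂) ⟩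
      Q ⊕ (+ l) · e₃ ⊕ a · e₁ ⊕ b · e₂           ∎)
    where
    open ≡-Reasoning
    ∣N·OQ∣≡l : m ≡ 2 → ∣ dot N (O ⊖ Q) ∣ ≡ l
    ∣N·OQ∣≡l refl = ℕₚ.*-cancelˡ-≡ ∣ dot N (O ⊖ Q) ∣ l 2 (begin
      2 ℕ.* ∣ dot N (O ⊖ Q) ∣                              ≡⟨ ∣height-diamond∣ Q e₁ e₂ (O ⊖ Q) ⟨
      ∣ height (Q ⊕ e₁) (Q ⊕ e₂) (Q ⊖ e₂) (Q ⊕ (O ⊖ Q)) ∣  ≡⟨ cong (λ X → ∣ height (Q ⊕ e₁) (Q ⊕ e₂) (Q ⊖ e₂) X ∣) (P⊕[X⊖P]≡X Q O) ⟩
      ∣ height (Q ⊕ e₁) (Q ⊕ e₂) (Q ⊖ e₂) O ∣              ≡⟨ ∣hO∣≡lm ⟩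
      l ℕ.* 2                                               ≡⟨ ℕₚ.*-comm l 2 ⟩
      2 ℕ.* l                                               ∎)

-- Integer points in the sections of the pyramid

-- With the apex at Q + L e₃ + a e₁ + b e₂, the section of the pyramid at height K is
-- (K/L)(a, b) + (1 - K/L){|s| + |t| ≤ 1} in the coordinates (s, t) along e₁, e₂.
InSection : (L K : ℕ) (a b s t : ℤ) → Set
InSection L K a b s t = K ℕ.+ (∣ + L * s - + K * a ∣ ℕ.+ ∣ + L * t - + K * b ∣) ≤ L

difference-of-parts : ∀ d → Σ ℕ λ p → Σ ℕ λ m → d ≡ + p - + m × p ℕ.+ m ≡ ∣ d ∣
difference-of-parts (+ n) = n , 0 , sym (ℤₚ.+-identityʳ (+ n)) , ℕₚ.+-identityʳ n
difference-of-parts -[1+ n ] = 0 , suc n , refl , refl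

section-identity : ∀ Q e₁ e₂ e₃ L K a b s t →
  (L + L) · (Q ⊕ K · e₃ ⊕ s · e₁ ⊕ t · e₂) ≡
  (K + K) · (Q ⊕ L · e₃ ⊕ a · e₁ ⊕ b · e₂) ⊕ ((L - K) + (L - K)) · Q
    ⊕ ((L * s - K * a) + (L * s - K * a)) · e₁ ⊕ ((L * t - K * b) + (L * t - K * b)) · e₂
section-identity (v3 q₁ q₂ q₃) (v3 u₁ u₂ u₃) (v3 v₁ v₂ v₃) (v3 w₁ w₂ w₃) L K a b s t =
  v3-cong (componentwise q₁ u₁ v₁ w₁ L K a b s t) (componentwise q₂ u₂ v₂ w₂ L K a b s t) (componentwise q₃ u₃ v₃ w₃ L K a b s t)
  where
  componentwise : ∀ (q u v w L K a b s t : ℤ) → (L + L) * (q + K * w + s * u + t * v) ≡ (K + K) * (q + L * w + a * u + b * v) + (L - K + (L - K)) * q + (L * s - K * a + (L * s - K * a)) * u + (L * t - K * b + (L * t - K * b)) * v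
  componentwise = solve-∀

weights-identity : ∀ O Q e₁ e₂ κ p₁ m₁ p₂ m₂ r →
  (κ + κ) · O ⊕ ((p₁ + m₁ + (p₂ + m₂) + r) + (p₁ + m₁ + (p₂ + m₂) + r)) · Q
    ⊕ ((p₁ - m₁) + (p₁ - m₁)) · e₁ ⊕ ((p₂ - m₂) + (p₂ - m₂)) · e₂ ≡
  (κ + κ) · O ⊕ ((p₁ + p₁ + r) · (Q ⊕ e₁) ⊕ ((p₂ + p₂) · (Q ⊕ e₂)
    ⊕ ((m₁ + m₁ + r) · (Q ⊖ e₁) ⊕ ((m₂ + m₂) · (Q ⊖ e₂) ⊕ origin))))
weights-identity (v3 o₁ o₂ o₃) (v3 q₁ q₂ q₃) (v3 u₁ u₂ u₃) (v3 v₁ v₂ v₃) κ p₁ m₁ p₂ m₂ r =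
  v3-cong (componentwise o₁ q₁ u₁ v₁ κ p₁ m₁ p₂ m₂ r) (componentwise o₂ q₂ u₂ v₂ κ p₁ m₁ p₂ m₂ r) (componentwise o₃ q₃ u₃ v₃ κ p₁ m₁ p₂ m₂ r)
  where
  componentwise : ∀ (o q u v κ p₁ m₁ p₂ m₂ r : ℤ) → (κ + κ) * o + (p₁ + m₁ + (p₂ + m₂) + r + (p₁ + m₁ + (p₂ + m₂) + r)) * q + (p₁ - m₁ + (p₁ - m₁)) * u + (p₂ - m₂ + (p₂ - m₂)) * v ≡ (κ + κ) * o + ((p₁ + p₁ + r) * (q + u) + ((p₂ + p₂) * (q + v) + ((m₁ + m₁ + r) * (q - u) + ((m₂ + m₂) * (q - v) + 0ℤ))))
  componentwise = solve-∀

weights-total : ∀ K p₁ m₁ p₂ m₂ r →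
  K ℕ.+ K ℕ.+ (p₁ ℕ.+ p₁ ℕ.+ r ℕ.+ (p₂ ℕ.+ p₂ ℕ.+ (m₁ ℕ.+ m₁ ℕ.+ r ℕ.+ (m₂ ℕ.+ m₂ ℕ.+ 0)))) ≡
  (p₁ ℕ.+ m₁ ℕ.+ (p₂ ℕ.+ m₂) ℕ.+ r ℕ.+ K) ℕ.+ (p₁ ℕ.+ m₁ ℕ.+ (p₂ ℕ.+ m₂) ℕ.+ r ℕ.+ K)
weights-total = ℕ-Solver.solve-∀

-- 2L X = 2K O + (2p₁ + r) A + 2p₂ B + (2m₁ + r) C + 2m₂ D, with the slack r shared by the
-- opposite vertices A and C.
weighted-point-in-pyramid : ∀ Q e₁ e₂ e₃ a b s t K p₁ m₁ p₂ m₂ r → 0 < K →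
  let L = p₁ ℕ.+ m₁ ℕ.+ (p₂ ℕ.+ m₂) ℕ.+ r ℕ.+ K in
  + L * s - + K * a ≡ + p₁ - + m₁ → + L * t - + K * b ≡ + p₂ - + m₂ →
  InPyramid (Q ⊕ (+ L) · e₃ ⊕ a · e₁ ⊕ b · e₂) (Q ⊕ e₁) (Q ⊕ e₂) (Q ⊖ e₁) (Q ⊖ e₂)
            (Q ⊕ (+ K) · e₃ ⊕ s · e₁ ⊕ t · e₂)
weighted-point-in-pyramid Q e₁ e₂ e₃ a b s t K p₁ m₁ p₂ m₂ r 0<K d₁≡ d₂≡ =
  weights , refl , ℕₚ.<-≤-trans 0<K (ℕₚ.≤-trans (ℕₚ.m≤m+n K K) (ℕₚ.m≤m+n (K ℕ.+ K) (sum others))) , (begin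
    (+ sum weights) · X
      ≡⟨ cong (λ n → (+ n) · X) (weights-total K p₁ m₁ p₂ m₂ r) ⟩
    (+ L + + L) · X
      ≡⟨ section-identity Q e₁ e₂ e₃ (+ L) (+ K) a b s t ⟩
    (+ K + + K) · O ⊕ ((+ L - + K) + (+ L - + K)) · Q
      ⊕ ((+ L * s - + K * a) + (+ L * s - + K * a)) · e₁ ⊕ ((+ L * t - + K * b) + (+ L * t - + K * b)) · e₂
      ≡⟨ cong₃ (λ R D₁ D₂ → (+ K + + K) · O ⊕ (R + R) · Q ⊕ (D₁ + D₁) · e₁ ⊕ (D₂ + D₂) · e₂)
               (i+j-j≡i (+ P) (+ K)) d₁≡ d₂≡ ⟩
    (+ K + + K) · O ⊕ (+ P + + P) · Q ⊕ ((+ p₁ - + m₁) + (+ p₁ - + m₁)) · e₁ ⊕ ((+ p₂ - + m₂) + (+ p₂ - + m₂)) · e₂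
      ≡⟨ weights-identity O Q e₁ e₂ (+ K) (+ p₁) (+ m₁) (+ p₂) (+ m₂) (+ r) ⟩
    lincomb weights (O ∷ Q ⊕ e₁ ∷ Q ⊕ e₂ ∷ Q ⊖ e₁ ∷ Q ⊖ e₂ ∷ [])   ∎)
  where
  open ≡-Reasoning
  others = p₁ ℕ.+ p₁ ℕ.+ r ∷ p₂ ℕ.+ p₂ ∷ m₁ ℕ.+ m₁ ℕ.+ r ∷ m₂ ℕ.+ m₂ ∷ []
  weights = K ℕ.+ K ∷ others
  P = p₁ ℕ.+ m₁ ℕ.+ (p₂ ℕ.+ m₂) ℕ.+ r
  L = P ℕ.+ K
  X = Q ⊕ (+ K) · e₃ ⊕ s · e₁ ⊕ t · e₂
  O = Q ⊕ (+ L) · e₃ ⊕ a · e₁ ⊕ b · e₂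

section⊆pyramid : ∀ Q e₁ e₂ e₃ L K a b s t → 0 < K → InSection L K a b s t →
  InPyramid (Q ⊕ (+ L) · e₃ ⊕ a · e₁ ⊕ b · e₂) (Q ⊕ e₁) (Q ⊕ e₂) (Q ⊖ e₁) (Q ⊖ e₂)
            (Q ⊕ (+ K) · e₃ ⊕ s · e₁ ⊕ t · e₂)
section⊆pyramid Q e₁ e₂ e₃ L K a b s t 0<K sec =
  let p₁ , m₁ , d₁≡ , p₁+m₁≡ = difference-of-parts (+ L * s - + K * a)
      p₂ , m₂ , d₂≡ , p₂+m₂≡ = difference-of-parts (+ L * t - + K * b)
      r , L≡ = ℕₚ.m≤n⇒∃[o]m+o≡n sec
      P+K≡L = trans (cong₂ (λ x y → x ℕ.+ y ℕ.+ r ℕ.+ K) p₁+m₁≡ p₂+m₂≡)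
                    (trans (move-K-first ∣ + L * s - + K * a ∣ ∣ + L * t - + K * b ∣ r K) L≡)
  in subst (λ L → InPyramid (Q ⊕ (+ L) · e₃ ⊕ a · e₁ ⊕ b · e₂) (Q ⊕ e₁) (Q ⊕ e₂) (Q ⊖ e₁) (Q ⊖ e₂)
                             (Q ⊕ (+ K) · e₃ ⊕ s · e₁ ⊕ t · e₂)) P+K≡L
       (weighted-point-in-pyramid Q e₁ e₂ e₃ a b s t K p₁ m₁ p₂ m₂ r 0<K
         (subst (λ L → + L * s - + K * a ≡ + p₁ - + m₁) (sym P+K≡L) d₁≡)
         (subst (λ L → + L * t - + K * b ≡ + p₂ - + m₂) (sym P+K≡L) d₂≡))
  where
  move-K-first : ∀ x y r K → x ℕ.+ y ℕ.+ r ℕ.+ K ≡ K ℕ.+ (x ℕ.+ y) ℕ.+ r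
  move-K-first = ℕ-Solver.solve-∀

level-in-frame : ∀ Q e₁ e₂ e₃ k s t → dot (cross e₁ e₂) ((Q ⊕ k · e₃ ⊕ s · e₁ ⊕ t · e₂) ⊖ Q) ≡ k * dot (cross e₁ e₂) e₃
level-in-frame (v3 q₁ q₂ q₃) (v3 a₁ a₂ a₃) (v3 b₁ b₂ b₃) (v3 c₁ c₂ c₃) k s t = expanded q₁ q₂ q₃ a₁ a₂ a₃ b₁ b₂ b₃ c₁ c₂ c₃ k s t
  where
  expanded : ∀ (q₁ q₂ q₃ a₁ a₂ a₃ b₁ b₂ b₃ c₁ c₂ c₃ k s t : ℤ) →
    (a₂ * b₃ - a₃ * b₂) * (q₁ + k * c₁ + s * a₁ + t * b₁ - q₁) + (a₃ * b₁ - a₁ * b₃) * (q₂ + k * c₂ + s * a₂ + t * b₂ - q₂) + (a₁ * b₂ - a₂ * b₁) * (q₃ + k * c₃ + s * a₃ + t * b₃ - q₃)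
      ≡ k * ((a₂ * b₃ - a₃ * b₂) * c₁ + (a₃ * b₁ - a₁ * b₃) * c₂ + (a₁ * b₂ - a₂ * b₁) * c₃)
  expanded = solve-∀

dot-⊖-scaled : ∀ S N X Q → S * dot N (X ⊖ Q) ≡ dot N (S · X) - S * dot N Q
dot-⊖-scaled S (v3 n₁ n₂ n₃) (v3 x₁ x₂ x₃) (v3 q₁ q₂ q₃) = expanded n₁ n₂ n₃ x₁ x₂ x₃ q₁ q₂ q₃ S
  where
  expanded : ∀ (n₁ n₂ n₃ x₁ x₂ x₃ q₁ q₂ q₃ S : ℤ) →
    S * (n₁ * (x₁ - q₁) + n₂ * (x₂ - q₂) + n₃ * (x₃ - q₃))
      ≡ n₁ * (S * x₁) + n₂ * (S * x₂) + n₃ * (S * x₃) - S * (n₁ * q₁ + n₂ * q₂ + n₃ * q₃)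
  expanded = solve-∀

diamond-combination-in-plane : ∀ Q e₁ e₂ w₁ w₂ w₃ w₄ →
  dot (cross e₁ e₂) (w₁ · (Q ⊕ e₁) ⊕ (w₂ · (Q ⊕ e₂) ⊕ (w₃ · (Q ⊖ e₁) ⊕ (w₄ · (Q ⊖ e₂) ⊕ origin))))
    - (w₁ + (w₂ + (w₃ + (w₄ + 0ℤ)))) * dot (cross e₁ e₂) Q ≡ 0ℤ
diamond-combination-in-plane (v3 q₁ q₂ q₃) (v3 a₁ a₂ a₃) (v3 b₁ b₂ b₃) w₁ w₂ w₃ w₄ = expanded q₁ q₂ q₃ a₁ a₂ a₃ b₁ b₂ b₃ w₁ w₂ w₃ w₄
  where
  expanded : ∀ (q₁ q₂ q₃ a₁ a₂ a₃ b₁ b₂ b₃ w₁ w₂ w₃ w₄ : ℤ) →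
    (a₂ * b₃ - a₃ * b₂) * (w₁ * (q₁ + a₁) + (w₂ * (q₁ + b₁) + (w₃ * (q₁ - a₁) + (w₄ * (q₁ - b₁) + 0ℤ)))) + (a₃ * b₁ - a₁ * b₃) * (w₁ * (q₂ + a₂) + (w₂ * (q₂ + b₂) + (w₃ * (q₂ - a₂) + (w₄ * (q₂ - b₂) + 0ℤ)))) + (a₁ * b₂ - a₂ * b₁) * (w₁ * (q₃ + a₃) + (w₂ * (q₃ + b₃) + (w₃ * (q₃ - a₃) + (w₄ * (q₃ - b₃) + 0ℤ)))) - (w₁ + (w₂ + (w₃ + (w₄ + 0ℤ)))) * ((a₂ * b₃ - a₃ * b₂) * q₁ + (a₃ * b₁ - a₁ * b₃) * q₂ + (a₁ * b₂ - a₂ * b₁) * q₃)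
      ≡ 0ℤ
  expanded = solve-∀

base-in-plane : ∀ Q e₁ e₂ X → InBase (Q ⊕ e₁) (Q ⊕ e₂) (Q ⊖ e₁) (Q ⊖ e₂) X → dot (cross e₁ e₂) (X ⊖ Q) ≡ 0ℤ
base-in-plane Q e₁ e₂ X (w₁ ∷ w₂ ∷ w₃ ∷ w₄ ∷ [] , refl , 0<S , SX≡) =
  cancel-nonzero-factor (+ S) (dot N (X ⊖ Q)) (λ S≡0 → ℕₚ.<-irrefl (sym (ℤₚ.+-injective S≡0)) 0<S)
    (trans (dot-⊖-scaled (+ S) N X Q)
    (trans (cong (λ Y → dot N Y - + S * dot N Q) SX≡)
           (diamond-combination-in-plane Q e₁ e₂ (+ w₁) (+ w₂) (+ w₃) (+ w₄))))
  where
  N = cross e₁ e₂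
  S = w₁ ℕ.+ (w₂ ℕ.+ (w₃ ℕ.+ (w₄ ℕ.+ 0)))

Hollow : ℕ → ℤ → ℤ → Set
Hollow L a b = ∀ K s t → 0 < K → K < L → ¬ InSection L K a b s t

empty⇒hollow : ∀ O Q e₁ e₂ e₃ L a b → O ≡ Q ⊕ (+ L) · e₃ ⊕ a · e₁ ⊕ b · e₂ → dot (cross e₁ e₂) e₃ ≢ 0ℤ →
  CompletelyEmpty O (Q ⊕ e₁) (Q ⊕ e₂) (Q ⊖ e₁) (Q ⊖ e₂) → Hollow L a b
empty⇒hollow O Q e₁ e₂ e₃ L a b refl ζ≢0 empty K s t 0<K K<L sec =
  [ apex , in-base ]′ (empty X (section⊆pyramid Q e₁ e₂ e₃ L K a b s t 0<K sec))
  where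
  N = cross e₁ e₂
  X = Q ⊕ (+ K) · e₃ ⊕ s · e₁ ⊕ t · e₂
  apex : X ≡ Q ⊕ (+ L) · e₃ ⊕ a · e₁ ⊕ b · e₂ → ⊥
  apex X≡O = ℕₚ.<-irrefl (ℤₚ.+-injective (ℤₚ.*-cancelʳ-≡ (+ K) (+ L) (dot N e₃) {{≢-nonZero ζ≢0}}
    (trans (sym (level-in-frame Q e₁ e₂ e₃ (+ K) s t))
    (trans (cong (λ Y → dot N (Y ⊖ Q)) X≡O) (level-in-frame Q e₁ e₂ e₃ (+ L) a b))))) K<L
  in-base : InBase (Q ⊕ e₁) (Q ⊕ e₂) (Q ⊖ e₁) (Q ⊖ e₂) X → ⊥
  in-base X∈base = ζ≢0 (cancel-nonzero-factor (+ K) (dot N e₃) (λ K≡0 → ℕₚ.<-irrefl (sym (ℤₚ.+-injective K≡0)) 0<K)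
    (trans (sym (level-in-frame Q e₁ e₂ e₃ (+ K) s t)) (base-in-plane Q e₁ e₂ X X∈base)))

-- Hollow pyramids are two-story

Odd : ℤ → Set
Odd a = Σ ℤ λ α → a ≡ + 1 + + 2 * α

twice : ∀ n → 2 ℕ.* n ≡ n ℕ.+ n
twice = ℕ-Solver.solve-∀

nearest-multiple-of-remainder : ∀ l r q → r < l → Σ ℤ λ s → 2 ℕ.* ∣ + l * s - (+ r + q * + l) ∣ ≤ l
nearest-multiple-of-remainder l r q r<l with 2 ℕ.* r ℕ.≤? l
... | yes 2r≤l = q , subst (λ n → 2 ℕ.* n ≤ l) (sym ∣∣≡r) 2r≤l
  where
  round-down : ∀ L R q → L * q - (R + q * L) ≡ - R
  round-down = solve-∀
  ∣∣≡r : ∣ + l * q - (+ r + q * + l) ∣ ≡ r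
  ∣∣≡r = trans (cong ∣_∣ (round-down (+ l) (+ r) q)) (ℤₚ.∣-i∣≡∣i∣ (+ r))
... | no 2r≰l = q + 1ℤ , subst (λ n → 2 ℕ.* n ≤ l) (sym ∣∣≡d) 2d≤l
  where
  open ℕₚ.≤-Reasoning
  d = l ℕ.∸ r
  r+d≡l : r ℕ.+ d ≡ l
  r+d≡l = ℕₚ.m+[n∸m]≡n (ℕₚ.<⇒≤ r<l)
  round-up : ∀ L R q → L * (q + 1ℤ) - (R + q * L) ≡ L - R
  round-up = solve-∀
  ∣∣≡d : ∣ + l * (q + 1ℤ) - (+ r + q * + l) ∣ ≡ d
  ∣∣≡d = cong ∣_∣ (trans (round-up (+ l) (+ r) q)
                        (trans (cong (λ n → + n - + r) (sym r+d≡l)) (i+j-i≡j (+ r) (+ d))))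
  d<r : d < r
  d<r = ℕₚ.+-cancelˡ-< r d r (begin-strict
    r ℕ.+ d     ≡⟨ r+d≡l ⟩
    l           <⟨ ℕₚ.≰⇒> 2r≰l ⟩
    2 ℕ.* r     ≡⟨ twice r ⟩
    r ℕ.+ r     ∎)
  2d≤l : 2 ℕ.* d ≤ l
  2d≤l = begin
    2 ℕ.* d     ≡⟨ twice d ⟩
    d ℕ.+ d     ≤⟨ ℕₚ.+-monoˡ-≤ d (ℕₚ.<⇒≤ d<r) ⟩
    r ℕ.+ d     ≡⟨ r+d≡l ⟩
    l           ∎

nearest-multiple : ∀ l a → 0 < l → Σ ℤ λ s → 2 ℕ.* ∣ + l * s - a ∣ ≤ l
nearest-multiple l@(suc _) a _ = subst (λ a → Σ ℤ λ s → 2 ℕ.* ∣ + l * s - a ∣ ≤ l) (sym (a≡a%ℕn+[a/ℕn]*n a l))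
  (nearest-multiple-of-remainder l (a %ℕ l) (a /ℕ l) (n%ℕd<d a l))

-- L s - d with d = ±L/2 lies halfway between two multiples of L, so its double is an odd multiple of L.
odd-multiple-of-double : ∀ L s d → L ≡ + 2 * d ⊎ L ≡ - (+ 2 * d) → Σ ℤ λ s′ → Odd s′ × L * s′ ≡ + 2 * (L * s - d)
odd-multiple-of-double .(+ 2 * d) s d (inj₁ refl) = s + s - 1ℤ , (s - 1ℤ , odd s) , even-multiple d s
  where
  odd : ∀ s → s + s - 1ℤ ≡ + 1 + + 2 * (s - 1ℤ)
  odd = solve-∀
  even-multiple : ∀ d s → + 2 * d * (s + s - 1ℤ) ≡ + 2 * (+ 2 * d * s - d)
  even-multiple = solve-∀
odd-multiple-of-double .(- (+ 2 * d)) s d (inj₂ refl) = s + s + 1ℤ , (s , odd s) , even-multiple d s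
  where
  odd : ∀ s → s + s + 1ℤ ≡ + 1 + + 2 * s
  odd = solve-∀
  even-multiple : ∀ d s → - (+ 2 * d) * (s + s + 1ℤ) ≡ + 2 * (- (+ 2 * d) * s - d)
  even-multiple = solve-∀

twice-abs-cases : ∀ d n → 2 ℕ.* ∣ d ∣ ≡ n → + n ≡ + 2 * d ⊎ + n ≡ - (+ 2 * d)
twice-abs-cases (+ k) .(2 ℕ.* k) refl = inj₁ (ℤₚ.pos-* 2 k)
twice-abs-cases -[1+ k ] .(2 ℕ.* suc k) refl = inj₂ refl

halfway⇒odd-multiple : ∀ l a s → 2 ℕ.* ∣ + l * s - a ∣ ≡ l → Σ ℤ λ s′ → Odd s′ × + l * s′ ≡ + 2 * a
halfway⇒odd-multiple l a s 2d≡l =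
  let s′ , odd , ls′≡ = odd-multiple-of-double (+ l) s (+ l * s - a) (twice-abs-cases (+ l * s - a) l 2d≡l)
  in s′ , odd , trans ls′≡ (cong (+ 2 *_) (−-cancel (+ l * s) a))
  where
  −-cancel : ∀ x a → x - (x - a) ≡ a
  −-cancel = solve-∀

both-halves : ∀ x y l → 2 ℕ.* x ≤ l → 2 ℕ.* y ≤ l → l ≤ x ℕ.+ y → 2 ℕ.* x ≡ l × 2 ℕ.* y ≡ l
both-halves x y l 2x≤l 2y≤l l≤x+y =
  ℕₚ.≤-antisym 2x≤l (half x y 2y≤l l≤x+y) , ℕₚ.≤-antisym 2y≤l (half y x 2x≤l (subst (l ≤_) (ℕₚ.+-comm x y) l≤x+y))
  where
  open ℕₚ.≤-Reasoning
  half : ∀ x y → 2 ℕ.* y ≤ l → l ≤ x ℕ.+ y → l ≤ 2 ℕ.* x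
  half x y 2y≤l l≤x+y = ℕₚ.+-cancelʳ-≤ l l (2 ℕ.* x) (begin
    l ℕ.+ l                   ≤⟨ ℕₚ.+-mono-≤ l≤x+y l≤x+y ⟩
    x ℕ.+ y ℕ.+ (x ℕ.+ y)     ≡⟨ regroup x y ⟩
    2 ℕ.* x ℕ.+ 2 ℕ.* y       ≤⟨ ℕₚ.+-monoʳ-≤ (2 ℕ.* x) 2y≤l ⟩
    2 ℕ.* x ℕ.+ l             ∎)
    where
    regroup : ∀ x y → x ℕ.+ y ℕ.+ (x ℕ.+ y) ≡ 2 ℕ.* x ℕ.+ 2 ℕ.* y
    regroup = ℕ-Solver.solve-∀

two-story : ∀ l a b → 1 < l → Hollow l a b → l ≡ 2 × Odd a × Odd b
two-story l a b 1<l hollow =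
  let s , 2da≤l = nearest-multiple l a (ℕₚ.<-trans (s≤s z≤n) 1<l)
      t , 2db≤l = nearest-multiple l b (ℕₚ.<-trans (s≤s z≤n) 1<l)
  in from-nearest s t 2da≤l 2db≤l
  where
  from-nearest : ∀ s t → 2 ℕ.* ∣ + l * s - a ∣ ≤ l → 2 ℕ.* ∣ + l * t - b ∣ ≤ l → l ≡ 2 × Odd a × Odd b
  from-nearest s t 2da≤l 2db≤l with ∣ + l * s - a ∣ ℕ.+ ∣ + l * t - b ∣ ℕ.<? l
  ... | yes fits = contradiction (subst₂ (λ a′ b′ → suc (∣ + l * s - a′ ∣ ℕ.+ ∣ + l * t - b′ ∣) ≤ l)
                                         (sym (ℤₚ.*-identityˡ a)) (sym (ℤₚ.*-identityˡ b)) fits)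
                                 (hollow 1 s t (s≤s z≤n) 1<l)
  ... | no overflows =
    let 2da≡l , 2db≡l = both-halves ∣ + l * s - a ∣ ∣ + l * t - b ∣ l 2da≤l 2db≤l (ℕₚ.≮⇒≥ overflows)
        s′ , s′-odd , ls′≡2a = halfway⇒odd-multiple l a s 2da≡l
        t′ , t′-odd , lt′≡2b = halfway⇒odd-multiple l b t 2db≡l
    in at-height-two s′ t′ s′-odd t′-odd ls′≡2a lt′≡2b
    where
    at-height-two : ∀ s′ t′ → Odd s′ → Odd t′ → + l * s′ ≡ + 2 * a → + l * t′ ≡ + 2 * b → l ≡ 2 × Odd a × Odd b
    at-height-two s′ t′ s′-odd t′-odd ls′≡2a lt′≡2b with 2 ℕ.<? l
    ... | yes 2<l = contradiction
          (subst₂ (λ m n → 2 ℕ.+ (∣ m ∣ ℕ.+ ∣ n ∣) ≤ l) (sym (ℤₚ.i≡j⇒i-j≡0 ls′≡2a)) (sym (ℤₚ.i≡j⇒i-j≡0 lt′≡2b))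
                  (ℕₚ.<⇒≤ 2<l))
          (hollow 2 s′ t′ (s≤s z≤n) 2<l)
    ... | no 2≮l with ℕₚ.≤-antisym (ℕₚ.≮⇒≥ 2≮l) 1<l
    ...   | refl = refl , subst Odd (ℤₚ.*-cancelˡ-≡ (+ 2) s′ a ls′≡2a) s′-odd
                        , subst Odd (ℤₚ.*-cancelˡ-≡ (+ 2) t′ b lt′≡2b) t′-odd

-- Unimodular changes of coordinates

-- Column j of δ times the matrix with rows r₁, r₂, r₃; the projection picks j.
column : ℤ → V3 → V3 → V3 → (V3 → ℤ) → V3
column δ r₁ r₂ r₃ π = δ · v3 (π r₁) (π r₂) (π r₃)

det3-transpose : ∀ δ r₁ r₂ r₃ → det3 (column δ r₁ r₂ r₃ V3.x) (column δ r₁ r₂ r₃ V3.y) (column δ r₁ r₂ r₃ V3.z)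
    ≡ δ * δ * δ * det3 r₁ r₂ r₃
det3-transpose δ (v3 a₁ a₂ a₃) (v3 b₁ b₂ b₃) (v3 c₁ c₂ c₃) = expanded a₁ a₂ a₃ b₁ b₂ b₃ c₁ c₂ c₃ δ
  where
  expanded : ∀ (a₁ a₂ a₃ b₁ b₂ b₃ c₁ c₂ c₃ δ : ℤ) →
    δ * a₁ * (δ * b₂ * (δ * c₃) - δ * c₂ * (δ * b₃)) + δ * b₁ * (δ * c₂ * (δ * a₃) - δ * a₂ * (δ * c₃)) + δ * c₁ * (δ * a₂ * (δ * b₃) - δ * b₂ * (δ * a₃))
      ≡ δ * δ * δ * (a₁ * (b₂ * c₃ - b₃ * c₂) + a₂ * (b₃ * c₁ - b₁ * c₃) + a₃ * (b₁ * c₂ - b₂ * c₁))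
  expanded = solve-∀

det3-cofactors : ∀ f₁ f₂ f₃ → det3 (cross f₂ f₃) (cross f₃ f₁) (cross f₁ f₂) ≡ det3 f₁ f₂ f₃ * det3 f₁ f₂ f₃
det3-cofactors (v3 a₁ a₂ a₃) (v3 b₁ b₂ b₃) (v3 c₁ c₂ c₃) = expanded a₁ a₂ a₃ b₁ b₂ b₃ c₁ c₂ c₃
  where
  expanded : ∀ (a₁ a₂ a₃ b₁ b₂ b₃ c₁ c₂ c₃ : ℤ) →
    (b₂ * c₃ - b₃ * c₂) * ((c₃ * a₁ - c₁ * a₃) * (a₁ * b₂ - a₂ * b₁) - (c₁ * a₂ - c₂ * a₁) * (a₃ * b₁ - a₁ * b₃)) + (b₃ * c₁ - b₁ * c₃) * ((c₁ * a₂ - c₂ * a₁) * (a₂ * b₃ - a₃ * b₂) - (c₂ * a₃ - c₃ * a₂) * (a₁ * b₂ - a₂ * b₁)) + (b₁ * c₂ - b₂ * c₁) * ((c₂ * a₃ - c₃ * a₂) * (a₃ * b₁ - a₁ * b₃) - (c₃ * a₁ - c₁ * a₃) * (a₂ * b₃ - a₃ * b₂))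
      ≡ (a₁ * (b₂ * c₃ - b₃ * c₂) + a₂ * (b₃ * c₁ - b₁ * c₃) + a₃ * (b₁ * c₂ - b₂ * c₁)) * (a₁ * (b₂ * c₃ - b₃ * c₂) + a₂ * (b₃ * c₁ - b₁ * c₃) + a₃ * (b₁ * c₂ - b₂ * c₁))
  expanded = solve-∀

cramer₁ : ∀ f₁ f₂ f₃ i j k → dot (cross f₂ f₃) (i · f₁ ⊕ j · f₂ ⊕ k · f₃) ≡ i * det3 f₁ f₂ f₃
cramer₁ (v3 a₁ a₂ a₃) (v3 b₁ b₂ b₃) (v3 c₁ c₂ c₃) i j k = expanded a₁ a₂ a₃ b₁ b₂ b₃ c₁ c₂ c₃ i j k
  where
  expanded : ∀ (a₁ a₂ a₃ b₁ b₂ b₃ c₁ c₂ c₃ i j k : ℤ) →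
    (b₂ * c₃ - b₃ * c₂) * (i * a₁ + j * b₁ + k * c₁) + (b₃ * c₁ - b₁ * c₃) * (i * a₂ + j * b₂ + k * c₂) + (b₁ * c₂ - b₂ * c₁) * (i * a₃ + j * b₃ + k * c₃)
      ≡ i * (a₁ * (b₂ * c₃ - b₃ * c₂) + a₂ * (b₃ * c₁ - b₁ * c₃) + a₃ * (b₁ * c₂ - b₂ * c₁))
  expanded = solve-∀

cramer₂ : ∀ f₁ f₂ f₃ i j k → dot (cross f₃ f₁) (i · f₁ ⊕ j · f₂ ⊕ k · f₃) ≡ j * det3 f₁ f₂ f₃
cramer₂ (v3 a₁ a₂ a₃) (v3 b₁ b₂ b₃) (v3 c₁ c₂ c₃) i j k = expanded a₁ a₂ a₃ b₁ b₂ b₃ c₁ c₂ c₃ i j k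
  where
  expanded : ∀ (a₁ a₂ a₃ b₁ b₂ b₃ c₁ c₂ c₃ i j k : ℤ) →
    (c₂ * a₃ - c₃ * a₂) * (i * a₁ + j * b₁ + k * c₁) + (c₃ * a₁ - c₁ * a₃) * (i * a₂ + j * b₂ + k * c₂) + (c₁ * a₂ - c₂ * a₁) * (i * a₃ + j * b₃ + k * c₃)
      ≡ j * (a₁ * (b₂ * c₃ - b₃ * c₂) + a₂ * (b₃ * c₁ - b₁ * c₃) + a₃ * (b₁ * c₂ - b₂ * c₁))
  expanded = solve-∀

cramer₃ : ∀ f₁ f₂ f₃ i j k → dot (cross f₁ f₂) (i · f₁ ⊕ j · f₂ ⊕ k · f₃) ≡ k * det3 f₁ f₂ f₃
cramer₃ (v3 a₁ a₂ a₃) (v3 b₁ b₂ b₃) (v3 c₁ c₂ c₃) i j k = expanded a₁ a₂ a₃ b₁ b₂ b₃ c₁ c₂ c₃ i j k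
  where
  expanded : ∀ (a₁ a₂ a₃ b₁ b₂ b₃ c₁ c₂ c₃ i j k : ℤ) →
    (a₂ * b₃ - a₃ * b₂) * (i * a₁ + j * b₁ + k * c₁) + (a₃ * b₁ - a₁ * b₃) * (i * a₂ + j * b₂ + k * c₂) + (a₁ * b₂ - a₂ * b₁) * (i * a₃ + j * b₃ + k * c₃)
      ≡ k * (a₁ * (b₂ * c₃ - b₃ * c₂) + a₂ * (b₃ * c₁ - b₁ * c₃) + a₃ * (b₁ * c₂ - b₂ * c₁))
  expanded = solve-∀

row-automorphism : (δ : ℤ) (r₁ r₂ r₃ P : V3) →
  Unimodular (det3 (column δ r₁ r₂ r₃ V3.x) (column δ r₁ r₂ r₃ V3.y) (column δ r₁ r₂ r₃ V3.z)) → IntAffAuto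
row-automorphism δ r₁ r₂ r₃ P =
  intAffAuto (column δ r₁ r₂ r₃ V3.x) (column δ r₁ r₂ r₃ V3.y) (column δ r₁ r₂ r₃ V3.z)
             (origin ⊖ δ · v3 (dot r₁ P) (dot r₂ P) (dot r₃ P))

apply-row-automorphism : ∀ δ r₁ r₂ r₃ P unimodular X →
  apply (row-automorphism δ r₁ r₂ r₃ P unimodular) X ≡ δ · v3 (dot r₁ (X ⊖ P)) (dot r₂ (X ⊖ P)) (dot r₃ (X ⊖ P))
apply-row-automorphism δ (v3 a₁ a₂ a₃) (v3 b₁ b₂ b₃) (v3 c₁ c₂ c₃) (v3 p₁ p₂ p₃) _ (v3 x₁ x₂ x₃) =
  v3-cong (law δ a₁ a₂ a₃ p₁ p₂ p₃ x₁ x₂ x₃) (law δ b₁ b₂ b₃ p₁ p₂ p₃ x₁ x₂ x₃) (law δ c₁ c₂ c₃ p₁ p₂ p₃ x₁ x₂ x₃)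
  where
  law : ∀ δ ρ₁ ρ₂ ρ₃ p₁ p₂ p₃ x₁ x₂ x₃ →
    0ℤ - δ * (ρ₁ * p₁ + ρ₂ * p₂ + ρ₃ * p₃) + x₁ * (δ * ρ₁) + x₂ * (δ * ρ₂) + x₃ * (δ * ρ₃)
      ≡ δ * (ρ₁ * (x₁ - p₁) + ρ₂ * (x₂ - p₂) + ρ₃ * (x₃ - p₃))
  law = solve-∀

unimodular-twice : ∀ {δ} → Unimodular δ → ∀ i j k → δ · v3 (i * δ) (j * δ) (k * δ) ≡ v3 i j k
unimodular-twice (inj₁ refl) i j k = v3-cong (law i) (law j) (law k)
  where
  law : ∀ i → 1ℤ * (i * 1ℤ) ≡ i
  law = solve-∀
unimodular-twice (inj₂ refl) i j k = v3-cong (law i) (law j) (law k)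
  where
  law : ∀ i → -1ℤ * (i * -1ℤ) ≡ i
  law = solve-∀

-- Cramer's rule: the rows are the cross products of the frame vectors, and 1 / δ = δ.
coordinate-automorphism : ∀ P f₁ f₂ f₃ → Unimodular (det3 f₁ f₂ f₃) →
  Σ IntAffAuto λ F → ∀ i j k → apply F (P ⊕ i · f₁ ⊕ j · f₂ ⊕ k · f₃) ≡ v3 i j k
coordinate-automorphism P f₁ f₂ f₃ unit = row-automorphism δ r₁ r₂ r₃ P unimodular , λ i j k → begin
  apply (row-automorphism δ r₁ r₂ r₃ P unimodular) (P ⊕ i · f₁ ⊕ j · f₂ ⊕ k · f₃)
    ≡⟨ apply-row-automorphism δ r₁ r₂ r₃ P unimodular (P ⊕ i · f₁ ⊕ j · f₂ ⊕ k · f₃) ⟩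
  δ · v3 (dot r₁ ((P ⊕ i · f₁ ⊕ j · f₂ ⊕ k · f₃) ⊖ P)) (dot r₂ ((P ⊕ i · f₁ ⊕ j · f₂ ⊕ k · f₃) ⊖ P))
         (dot r₃ ((P ⊕ i · f₁ ⊕ j · f₂ ⊕ k · f₃) ⊖ P))
    ≡⟨ cong (λ w → δ · v3 (dot r₁ w) (dot r₂ w) (dot r₃ w)) ([P⊕u⊕v⊕w]⊖P≡u⊕v⊕w P (i · f₁) (j · f₂) (k · f₃)) ⟩
  δ · v3 (dot r₁ (i · f₁ ⊕ j · f₂ ⊕ k · f₃)) (dot r₂ (i · f₁ ⊕ j · f₂ ⊕ k · f₃)) (dot r₃ (i · f₁ ⊕ j · f₂ ⊕ k · f₃))
    ≡⟨ cong₃ (λ a b c → δ · v3 a b c) (cramer₁ f₁ f₂ f₃ i j k) (cramer₂ f₁ f₂ f₃ i j k) (cramer₃ f₁ f₂ f₃ i j k) ⟩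
  δ · v3 (i * δ) (j * δ) (k * δ)
    ≡⟨ unimodular-twice unit i j k ⟩
  v3 i j k ∎
  where
  open ≡-Reasoning
  δ = det3 f₁ f₂ f₃
  r₁ = cross f₂ f₃
  r₂ = cross f₃ f₁
  r₃ = cross f₁ f₂
  unimodular : Unimodular (det3 (column δ r₁ r₂ r₃ V3.x) (column δ r₁ r₂ r₃ V3.y) (column δ r₁ r₂ r₃ V3.z))
  unimodular = subst Unimodular
    (sym (trans (det3-transpose δ r₁ r₂ r₃) (cong (δ * δ * δ *_) (det3-cofactors f₁ f₂ f₃))))
    (unimodular-fifth-power unit)

two-story-frame-det : ∀ e₁ e₂ E → det3 (-1ℤ · (E ⊕ e₂)) (-1ℤ · e₂) (-1ℤ · e₁) ≡ dot (cross e₁ e₂) E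
two-story-frame-det (v3 u₁ u₂ u₃) (v3 v₁ v₂ v₃) (v3 E₁ E₂ E₃) = expanded u₁ u₂ u₃ v₁ v₂ v₃ E₁ E₂ E₃
  where
  expanded : ∀ (u₁ u₂ u₃ v₁ v₂ v₃ E₁ E₂ E₃ : ℤ) →
    -1ℤ * (E₁ + v₁) * (-1ℤ * v₂ * (-1ℤ * u₃) - -1ℤ * v₃ * (-1ℤ * u₂)) + -1ℤ * (E₂ + v₂) * (-1ℤ * v₃ * (-1ℤ * u₁) - -1ℤ * v₁ * (-1ℤ * u₃)) + -1ℤ * (E₃ + v₃) * (-1ℤ * v₁ * (-1ℤ * u₂) - -1ℤ * v₂ * (-1ℤ * u₁))
      ≡ (u₂ * v₃ - u₃ * v₂) * E₁ + (u₃ * v₁ - u₁ * v₃) * E₂ + (u₁ * v₂ - u₂ * v₁) * E₃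
  expanded = solve-∀

two-story-vertices : ∀ Q e₁ e₂ E →
  let O  = Q ⊕ (+ 2) · E ⊕ e₁ ⊕ e₂
      f₁ = -1ℤ · (E ⊕ e₂)
      f₂ = -1ℤ · e₂
      f₃ = -1ℤ · e₁
  in (O ≡ O ⊕ (+ 0) · f₁ ⊕ (+ 0) · f₂ ⊕ (+ 0) · f₃)
   × (Q ⊕ e₁ ≡ O ⊕ (+ 2) · f₁ ⊕ -[1+ 0 ] · f₂ ⊕ (+ 0) · f₃)
   × (Q ⊕ e₂ ≡ O ⊕ (+ 2) · f₁ ⊕ -[1+ 1 ] · f₂ ⊕ (+ 1) · f₃)
   × (Q ⊖ e₁ ≡ O ⊕ (+ 2) · f₁ ⊕ -[1+ 0 ] · f₂ ⊕ (+ 2) · f₃)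
   × (Q ⊖ e₂ ≡ O ⊕ (+ 2) · f₁ ⊕ (+ 0) · f₂ ⊕ (+ 1) · f₃)
two-story-vertices (v3 q₁ q₂ q₃) (v3 u₁ u₂ u₃) (v3 v₁ v₂ v₃) (v3 E₁ E₂ E₃) =
  v3-cong (O≡ q₁ u₁ v₁ E₁) (O≡ q₂ u₂ v₂ E₂) (O≡ q₃ u₃ v₃ E₃) ,
  v3-cong (A≡ q₁ u₁ v₁ E₁) (A≡ q₂ u₂ v₂ E₂) (A≡ q₃ u₃ v₃ E₃) ,
  v3-cong (B≡ q₁ u₁ v₁ E₁) (B≡ q₂ u₂ v₂ E₂) (B≡ q₃ u₃ v₃ E₃) ,
  v3-cong (C≡ q₁ u₁ v₁ E₁) (C≡ q₂ u₂ v₂ E₂) (C≡ q₃ u₃ v₃ E₃) ,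
  v3-cong (D≡ q₁ u₁ v₁ E₁) (D≡ q₂ u₂ v₂ E₂) (D≡ q₃ u₃ v₃ E₃)
  where
  O≡ : ∀ (q u v E : ℤ) → q + (+ 2) * E + u + v ≡ q + (+ 2) * E + u + v + (+ 0) * (-1ℤ * (E + v)) + (+ 0) * (-1ℤ * v) + (+ 0) * (-1ℤ * u)
  O≡ = solve-∀
  A≡ : ∀ (q u v E : ℤ) → q + u ≡ q + (+ 2) * E + u + v + (+ 2) * (-1ℤ * (E + v)) + -[1+ 0 ] * (-1ℤ * v) + (+ 0) * (-1ℤ * u)
  A≡ = solve-∀
  B≡ : ∀ (q u v E : ℤ) → q + v ≡ q + (+ 2) * E + u + v + (+ 2) * (-1ℤ * (E + v)) + -[1+ 1 ] * (-1ℤ * v) + (+ 1) * (-1ℤ * u)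
  B≡ = solve-∀
  C≡ : ∀ (q u v E : ℤ) → q - u ≡ q + (+ 2) * E + u + v + (+ 2) * (-1ℤ * (E + v)) + -[1+ 0 ] * (-1ℤ * v) + (+ 2) * (-1ℤ * u)
  C≡ = solve-∀
  D≡ : ∀ (q u v E : ℤ) → q - v ≡ q + (+ 2) * E + u + v + (+ 2) * (-1ℤ * (E + v)) + (+ 0) * (-1ℤ * v) + (+ 1) * (-1ℤ * u)
  D≡ = solve-∀

two-story-equiv : ∀ O Q e₁ e₂ E → O ≡ Q ⊕ (+ 2) · E ⊕ e₁ ⊕ e₂ → Unimodular (dot (cross e₁ e₂) E) →
  PyramidEquiv O (Q ⊕ e₁) (Q ⊕ e₂) (Q ⊖ e₁) (Q ⊖ e₂)
    (v3 (+ 0) (+ 0) (+ 0))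
    (v3 (+ 2) -[1+ 0 ] (+ 0)) (v3 (+ 2) -[1+ 1 ] (+ 1))
    (v3 (+ 2) -[1+ 0 ] (+ 2)) (v3 (+ 2) (+ 0) (+ 1))
two-story-equiv O Q e₁ e₂ E refl unit =
  let O≡ , A≡ , B≡ , C≡ , D≡ = two-story-vertices Q e₁ e₂ E
      F , coordinates = coordinate-automorphism O f₁ f₂ f₃ (subst Unimodular (sym (two-story-frame-det e₁ e₂ E)) unit)
      at = λ X i j k (X≡ : X ≡ O ⊕ i · f₁ ⊕ j · f₂ ⊕ k · f₃) → trans (cong (apply F) X≡) (coordinates i j k)
  in F , at O (+ 0) (+ 0) (+ 0) O≡ ,
     ↭-reflexive (cong₂ _∷_ (at (Q ⊕ e₁) (+ 2) -[1+ 0 ] (+ 0) A≡)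
                 (cong₂ _∷_ (at (Q ⊕ e₂) (+ 2) -[1+ 1 ] (+ 1) B≡)
                 (cong₂ _∷_ (at (Q ⊖ e₁) (+ 2) -[1+ 0 ] (+ 2) C≡)
                 (cong₂ _∷_ (at (Q ⊖ e₂) (+ 2) (+ 0) (+ 1) D≡) refl))))
  where
  f₁ = -1ℤ · (E ⊕ e₂)
  f₂ = -1ℤ · e₂
  f₃ = -1ℤ · e₁

recentre-odd-apex : ∀ Q e₁ e₂ e₃ α β →
  Q ⊕ (+ 2) · e₃ ⊕ (+ 1 + + 2 * α) · e₁ ⊕ (+ 1 + + 2 * β) · e₂ ≡ Q ⊕ (+ 2) · (e₃ ⊕ α · e₁ ⊕ β · e₂) ⊕ e₁ ⊕ e₂
recentre-odd-apex (v3 q₁ q₂ q₃) (v3 u₁ u₂ u₃) (v3 v₁ v₂ v₃) (v3 w₁ w₂ w₃) α β =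
  v3-cong (law q₁ u₁ v₁ w₁ α β) (law q₂ u₂ v₂ w₂ α β) (law q₃ u₃ v₃ w₃ α β)
  where
  law : ∀ (q u v w α β : ℤ) → q + (+ 2) * w + ((+ 1) + (+ 2) * α) * u + ((+ 1) + (+ 2) * β) * v ≡ q + (+ 2) * (w + α * u + β * v) + u + v
  law = solve-∀

dot-normal-shear : ∀ e₁ e₂ e₃ α β → dot (cross e₁ e₂) (e₃ ⊕ α · e₁ ⊕ β · e₂) ≡ dot (cross e₁ e₂) e₃
dot-normal-shear (v3 u₁ u₂ u₃) (v3 v₁ v₂ v₃) (v3 w₁ w₂ w₃) α β = expanded u₁ u₂ u₃ v₁ v₂ v₃ w₁ w₂ w₃ α β
  where
  expanded : ∀ (u₁ u₂ u₃ v₁ v₂ v₃ w₁ w₂ w₃ α β : ℤ) →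
    (u₂ * v₃ - u₃ * v₂) * (w₁ + α * u₁ + β * v₁) + (u₃ * v₁ - u₁ * v₃) * (w₂ + α * u₂ + β * v₂) + (u₁ * v₂ - u₂ * v₁) * (w₃ + α * u₃ + β * v₃)
      ≡ (u₂ * v₃ - u₃ * v₂) * w₁ + (u₃ * v₁ - u₁ * v₃) * w₂ + (u₁ * v₂ - u₂ * v₁) * w₃
  expanded = solve-∀

mainTheorem10 : (O A B C D : V3) →
    BaseIsStandardDiamond A B C D →
    height A B D O ≢ + 0 →
    CompletelyEmpty O A B C D →
    (Σ ℕ λ l → IntegerDistance O A B D l × 1 < l) →
    IntegerDistance O A B D 2 ×
    PyramidEquiv O A B C D
      (v3 (+ 0) (+ 0) (+ 0))
      (v3 (+ 2) -[1+ 0 ] (+ 0)) (v3 (+ 2) -[1+ 1 ] (+ 1))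
      (v3 (+ 2) -[1+ 0 ] (+ 2)) (v3 (+ 2) (+ 0) (+ 1))
mainTheorem10 O _ _ _ _ (Q , e₁ , e₂ , lattice , refl , refl , refl , refl) _ empty (l , distance , 1<l) =
  -- O lying off the base plane already follows from 1 < l.
  let e₃ , a , b , unit , O≡ = PlaneLattice.apex-normal-form Q e₁ e₂ lattice O l distance
      l≡2 , (α , a≡) , (β , b≡) = two-story l a b 1<l (empty⇒hollow O Q e₁ e₂ e₃ l a b O≡ (unimodular≢0 unit) empty)
  in subst (IntegerDistance O (Q ⊕ e₁) (Q ⊕ e₂) (Q ⊖ e₂)) l≡2 distance ,
     two-story-equiv O Q e₁ e₂ (e₃ ⊕ α · e₁ ⊕ β · e₂)
       (trans O≡ (trans (cong₃ (λ l a b → Q ⊕ (+ l) · e₃ ⊕ a · e₁ ⊕ b · e₂) l≡2 a≡ b≡) (recentre-odd-apex Q e₁ e₂ e₃ α β)))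
       (subst Unimodular (sym (dot-normal-shear e₁ e₂ e₃ α β)) unit)
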